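{- Let $s,t$ be odd integers with $s \geq t \geq 7$, and let $T_{s,t}=C_s\,\Box\,C_t$ be the $s\times t$ toroidal grid. Then the matching book thickness of $T_{s,t}$ satisfies $mbt(T_{s,t})\leq 5$; that is, $T_{s,t}$ admits a $5$-page matching book embedding.
   Context: For a graph $G$, a layout is obtained by choosing a permutation $\psi$ of $V(G)$, placing the vertices on a circle in the order $\psi$, and drawing every edge as a chord. Two edges cross in this layout if their four endpoints are distinct and interleave along the circle. An $m$-page book embedding is a triple $(G,\psi,c)$ where $c:E(G)\to S$ with $|S|=m$ is an edge-coloring such that any two crossing edges receive different colors. It is a matching book embedding if in addition $c$ is a proper edge-coloring (edges sharing an endpoint receive different colors), so each color class is a matching with no crossings. The matching book thickness $mbt(G)$ is the minimum $m$ such that $G$ has an $m$-page matching book embedding. The toroidal grid $T_{s,t}$ is the Cartesian product $C_s\,\Box\,C_t$ of the cycles $C_s$ and $C_t$, with vertex set $\{(p,q): 1\le p\le s,\ 1\le q\le t\}$, where $(p,q)$ and $(p',q')$ are adjacent iff either $p=p'$ and $q'\equiv q\pm1 \pmod t$, or $q=q'$ and $p'\equiv p\pm1\pmod s$. -}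

module Defs where

open import Data.Nat using (ℕ; suc; _+_; _*_; _<_; _≤_; NonZero)
open import Data.Fin using (Fin; toℕ)
open import Data.Product using (_×_; Σ; _,_)
open import Data.Sum using (_⊎_)
open import Relation.Binary.PropositionalEquality using (_≡_)
open import Relation.Nullary using (¬_)
open import Function.Bundles using (_⤖_; Bijection)

record Graph : Set₁ where
  field
    V   : Set
    Adj : V → V → Set

Succ : (n : ℕ) → Fin n → Fin n → Set
Succ n q q' = (suc (toℕ q) ≡ toℕ q') ⊎ (suc (toℕ q) ≡ n × toℕ q' ≡ 0)

CycAdj : (n : ℕ) → Fin n → Fin n → Set
CycAdj n q q' = Succ n q q' ⊎ Succ n q' q

TorAdj : (s t : ℕ) →
         Fin s × Fin t → Fin s × Fin t → Set
TorAdj s t (p , q) (p' , q') = (p ≡ p' × CycAdj t q q') ⊎ (q ≡ q' × CycAdj s p p')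

Torus : (s t : ℕ) → Graph
Torus s t = record { V = Fin s × Fin t ; Adj = TorAdj s t }

Between : ℕ → ℕ → ℕ → Set
Between x y z = (x < z × z < y) ⊎ (y < z × z < x)

-- Chords {a,b} and {c,d} (positions on the circle) cross: four distinct
-- endpoints that interleave, i.e. exactly one of c, d lies between a and b.
Cross : ℕ → ℕ → ℕ → ℕ → Set
Cross a b c d =
  ¬ a ≡ b × ¬ a ≡ c × ¬ a ≡ d × ¬ b ≡ c × ¬ b ≡ d × ¬ c ≡ d ×
  ((Between a b c × ¬ Between a b d) ⊎ (¬ Between a b c × Between a b d))

-- An m-page matching book embedding of G with N vertices: a placement
-- ψ : V ≅ Fin N (circular order) and an edge colouring c with m colours
-- (given on ordered adjacent pairs, symmetric so it is a colouring of edges)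
-- that is proper and gives crossing edges distinct colours.
record MatchingBookEmbedding (G : Graph) (N m : ℕ) : Set where
  open Graph G
  field
    ψ       : V ⤖ Fin N
    colour  : (u v : V) → Adj u v → Fin m
    symm    : ∀ u v (e : Adj u v) (e' : Adj v u) → colour u v e ≡ colour v u e'
    proper  : ∀ u v w (e : Adj u v) (e' : Adj u w) → ¬ v ≡ w →
              ¬ colour u v e ≡ colour u w e'
    noCross : ∀ a b c d (e : Adj a b) (e' : Adj c d) →
              Cross (toℕ (Bijection.to ψ a)) (toℕ (Bijection.to ψ b))
                    (toℕ (Bijection.to ψ c)) (toℕ (Bijection.to ψ d)) →
              ¬ colour a b e ≡ colour c d e'

-- Write t = 2h + 1 and s = m + 2 with m odd. Columns 0 and s − 1 are interleaved on the first
-- 2t positions of the circle (row q of one of them at 2q, of the other at 2q + 1), and each middle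
-- column P fills the block of positions [(P + 1)t, (P + 2)t), running up or down according to the
-- parity of P. Almost every edge then joins neighbouring positions and crosses nothing. The
-- exceptions are the legs of length 3 of the two interleaved columns, the wrap-around edge of each
-- column and the bridges between consecutive blocks, which are nested around the block boundary.
-- Bridges shorter than h go on page A, longer ones alternate between pages B and C from one
-- boundary to the next, and legs and wraps are spread over the pages so that any two long chords on
-- the same page are nested or disjoint. Properness is checked vertex by vertex, row by row.

module Submission where

open import Defs
open import Data.Nat using (ℕ; _≤_; _*_)
open import Data.Nat.Base using (_%_)
open import Relation.Binary.PropositionalEquality using (_≡_)

open import Data.Bool using (Bool; true; false; if_then_else_; not)
open import Data.Bool.Properties using (not-involutive; not-¬)
open import Data.Empty using (⊥-elim)
open import Data.Fin using (Fin; toℕ; fromℕ<; remQuot; combine; punchOut) renaming (zero to fzero; suc to fsuc)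
open import Data.Fin.Properties using (toℕ<n; toℕ-fromℕ<; toℕ-injective; combine-remQuot; punchOut-injective; injective⇒≤; any?) renaming (_≟_ to _≟ᶠ_)
open import Data.Nat
open import Data.Nat.DivMod using (m≡m%n+[m/n]*n; _/_)
open import Data.Nat.Properties
open import Data.Product using (_×_; _,_; proj₁; proj₂; ∃; uncurry)
open import Data.Sum using (_⊎_; inj₁; inj₂)
open import Data.Unit using (⊤; tt)
open import Function.Base using (_∘_)
open import Function.Bundles using (_⤖_; mk⤖)
open import Function.Definitions using (Injective)
open import Relation.Binary.Definitions using (tri<; tri≈; tri>)
open import Relation.Binary.PropositionalEquality
open import Relation.Nullary using (¬_; yes; no; does)
open import Relation.Nullary.Decidable using (False; toWitnessFalse; fromWitnessFalse; dec-true; dec-false)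

-- Chords on a line

private variable
  n lo hi lo′ hi′ x y x′ y′ z : ℕ

Ends : ℕ → ℕ → ℕ → ℕ → Set
Ends x y lo hi = (x ≡ lo × y ≡ hi) ⊎ (x ≡ hi × y ≡ lo)

Interleave : ℕ → ℕ → ℕ → ℕ → Set
Interleave lo hi lo′ hi′ = (lo < lo′ × lo′ < hi × hi < hi′) ⊎ (lo′ < lo × lo < hi′ × hi′ < hi)

interleave-sym : Interleave lo hi lo′ hi′ → Interleave lo′ hi′ lo hi
interleave-sym (inj₁ i) = inj₂ i
interleave-sym (inj₂ i) = inj₁ i

between-sym : Between x y z → Between y x z
between-sym (inj₁ b) = inj₂ b
between-sym (inj₂ b) = inj₁ b

cross-swapˡ : Cross x y x′ y′ → Cross y x x′ y′
cross-swapˡ (d₁ , d₂ , d₃ , d₄ , d₅ , d₆ , inj₁ (b , nb)) =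
  (d₁ ∘ sym) , d₄ , d₅ , d₂ , d₃ , d₆ , inj₁ (between-sym b , nb ∘ between-sym)
cross-swapˡ (d₁ , d₂ , d₃ , d₄ , d₅ , d₆ , inj₂ (nb , b)) =
  (d₁ ∘ sym) , d₄ , d₅ , d₂ , d₃ , d₆ , inj₂ (nb ∘ between-sym , between-sym b)

cross-swapʳ : Cross x y x′ y′ → Cross x y y′ x′
cross-swapʳ (d₁ , d₂ , d₃ , d₄ , d₅ , d₆ , inj₁ (b , nb)) = d₁ , d₃ , d₂ , d₅ , d₄ , (d₆ ∘ sym) , inj₂ (nb , b)
cross-swapʳ (d₁ , d₂ , d₃ , d₄ , d₅ , d₆ , inj₂ (nb , b)) = d₁ , d₃ , d₂ , d₅ , d₄ , (d₆ ∘ sym) , inj₁ (b , nb)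

cross-ends : Ends x y lo hi → Ends x′ y′ lo′ hi′ → Cross x y x′ y′ → Cross lo hi lo′ hi′
cross-ends (inj₁ (refl , refl)) (inj₁ (refl , refl)) = λ c → c
cross-ends (inj₁ (refl , refl)) (inj₂ (refl , refl)) = cross-swapʳ
cross-ends (inj₂ (refl , refl)) (inj₁ (refl , refl)) = cross-swapˡ
cross-ends (inj₂ (refl , refl)) (inj₂ (refl , refl)) = cross-swapˡ ∘ cross-swapʳ

cross⇒interleave : lo < hi → lo′ < hi′ → Cross lo hi lo′ hi′ → Interleave lo hi lo′ hi′
cross⇒interleave {lo} {hi} {lo′} {hi′} l l′ (_ , _ , _ , _ , d₅ , _ , inj₁ (inj₁ (a , b) , nb)) with <-cmp hi hi′
... | tri< c _ _ = inj₁ (a , b , c)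
... | tri≈ _ c _ = ⊥-elim (d₅ c)
... | tri> _ _ c = ⊥-elim (nb (inj₁ (<-trans a l′ , c)))
cross⇒interleave {lo} {hi} {lo′} {hi′} l l′ (_ , d₂ , _ , _ , _ , _ , inj₂ (nb , inj₁ (a , b))) with <-cmp lo′ lo
... | tri< c _ _ = inj₂ (c , a , b)
... | tri≈ _ c _ = ⊥-elim (d₂ (sym c))
... | tri> _ _ c = ⊥-elim (nb (inj₁ (c , <-trans l′ b)))
cross⇒interleave l _ (_ , _ , _ , _ , _ , _ , inj₁ (inj₂ (a , b) , _)) = ⊥-elim (<-asym l (<-trans a b))
cross⇒interleave l _ (_ , _ , _ , _ , _ , _ , inj₂ (_ , inj₂ (a , b))) = ⊥-elim (<-asym l (<-trans a b))

¬interleave-nested : lo ≤ lo′ → hi′ ≤ hi → ¬ Interleave lo hi lo′ hi′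
¬interleave-nested _ b (inj₁ (_ , _ , c)) = <⇒≱ c b
¬interleave-nested a _ (inj₂ (c , _ , _)) = <⇒≱ c a

¬interleave-disjoint : lo < hi → hi ≤ lo′ → ¬ Interleave lo hi lo′ hi′
¬interleave-disjoint _ a (inj₁ (_ , c , _)) = <⇒≱ c a
¬interleave-disjoint l a (inj₂ (c , _ , _)) = <⇒≱ (<-trans c l) a

¬interleave-unit : ¬ Interleave lo (suc lo) lo′ hi′
¬interleave-unit (inj₁ (c , d , _)) = <⇒≱ c (s≤s⁻¹ d)
¬interleave-unit (inj₂ (_ , c , d)) = <⇒≱ c (s≤s⁻¹ d)

module _ {L R : ℕ → ℕ} where

  ¬interleave-growing : (∀ {j j′} → j ≤ j′ → L j′ ≤ L j) → (∀ {j j′} → j ≤ j′ → R j ≤ R j′) →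
                        ∀ j j′ → ¬ Interleave (L j) (R j) (L j′) (R j′)
  ¬interleave-growing L↓ R↑ j j′ with ≤-total j j′
  ... | inj₁ j≤j′ = ¬interleave-nested (L↓ j≤j′) (R↑ j≤j′) ∘ interleave-sym
  ... | inj₂ j′≤j = ¬interleave-nested (L↓ j′≤j) (R↑ j′≤j)

  ¬interleave-shrinking : (∀ {j j′} → j ≤ j′ → L j ≤ L j′) → (∀ {j j′} → j ≤ j′ → R j′ ≤ R j) →
                          ∀ j j′ → ¬ Interleave (L j) (R j) (L j′) (R j′)
  ¬interleave-shrinking L↑ R↓ j j′ with ≤-total j j′
  ... | inj₁ j≤j′ = ¬interleave-nested (L↑ j≤j′) (R↓ j≤j′)
  ... | inj₂ j′≤j = ¬interleave-nested (L↑ j′≤j) (R↓ j′≤j) ∘ interleave-sym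

-- Cyclic successors

CycSucc : ℕ → ℕ → ℕ → Set
CycSucc n x y = suc x ≡ y ⊎ (suc x ≡ n × y ≡ 0)

cycPred : ℕ → ℕ → ℕ
cycPred n zero    = pred n
cycPred n (suc x) = x

cycSucc-asym : 3 ≤ n → CycSucc n x y → ¬ CycSucc n y x
cycSucc-asym _ (inj₁ refl) (inj₁ e)               = <⇒≢ (≤-trans (n≤1+n _) (n<1+n _)) (sym e)
cycSucc-asym l (inj₁ refl) (inj₂ (e , refl))      = <⇒≢ l e
cycSucc-asym l (inj₂ (e , refl)) (inj₁ refl)      = <⇒≢ l e
cycSucc-asym l (inj₂ (e , refl)) (inj₂ (_ , refl)) = <⇒≢ (≤-trans (s≤s (s≤s z≤n)) l) e

cycSucc-irrefl : 2 ≤ n → CycSucc n x y → x ≢ y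
cycSucc-irrefl _ (inj₁ refl) e        = <⇒≢ (n<1+n _) e
cycSucc-irrefl l (inj₂ (e , refl)) refl = <⇒≢ l e

cycSucc-functional : y < n → y′ < n → CycSucc n x y → CycSucc n x y′ → y ≡ y′
cycSucc-functional _ _  (inj₁ refl) (inj₁ refl)             = refl
cycSucc-functional l _  (inj₁ refl) (inj₂ (e , refl))       = ⊥-elim (<⇒≢ l e)
cycSucc-functional _ l′ (inj₂ (e , refl)) (inj₁ refl)       = ⊥-elim (<⇒≢ l′ e)
cycSucc-functional _ _  (inj₂ (_ , refl)) (inj₂ (_ , refl)) = refl

cycSucc⇒cycPred : CycSucc n y x → y ≡ cycPred n x
cycSucc⇒cycPred {x = zero}  (inj₂ (e , _)) = cong pred e
cycSucc⇒cycPred {x = suc x} (inj₁ e)       = suc-injective e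

-- Bijections from injections

injective⇒surjective : (f : Fin n → Fin n) → Injective _≡_ _≡_ f → ∀ y → ∃ λ x → f x ≡ y
injective⇒surjective {suc n} f f-inj y with any? (λ x → f x ≟ᶠ y)
... | yes found = found
... | no missed = ⊥-elim (<⇒≱ (n<1+n n) (injective⇒≤ {f = g} g-inj))
  where
  g : Fin (suc n) → Fin n
  g x = punchOut {i = y} {j = f x} (λ e → missed (x , sym e))
  g-inj : Injective _≡_ _≡_ g
  g-inj {x} {x′} = f-inj ∘ punchOut-injective (λ e → missed (x , sym e)) (λ e → missed (x′ , sym e))

injective⇒bijection : ∀ {m k N} (f : Fin m × Fin k → Fin N) → m * k ≡ N → Injective _≡_ _≡_ f →
                      (Fin m × Fin k) ⤖ Fin N
injective⇒bijection {m} {k} f refl f-inj = mk⤖ (f-inj , λ y → proj₁ (preimage y) , λ { refl → proj₂ (preimage y) })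
  where
  f′ : Fin (m * k) → Fin (m * k)
  f′ = f ∘ remQuot k
  f′-inj : Injective _≡_ _≡_ f′
  f′-inj {i} {j} e = begin
    i                                  ≡⟨ combine-remQuot {m} k i ⟨
    uncurry combine (remQuot {m} k i)  ≡⟨ cong (uncurry combine) (f-inj e) ⟩
    uncurry combine (remQuot {m} k j)  ≡⟨ combine-remQuot {m} k j ⟩
    j                                  ∎
    where open ≡-Reasoning
  preimage : ∀ y → ∃ λ u → f u ≡ y
  preimage y with i , e ← injective⇒surjective f′ f′-inj y = remQuot k i , e

-- Matching book embeddings of the torus from layouts

Distinct4 : ∀ {k} → Fin k → Fin k → Fin k → Fin k → Set
Distinct4 a b c d = False (a ≟ᶠ b) × False (a ≟ᶠ c) × False (a ≟ᶠ d) × False (b ≟ᶠ c) × False (b ≟ᶠ d) × False (c ≟ᶠ d)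

False-sym : ∀ {k} {a b : Fin k} → False (a ≟ᶠ b) → False (b ≟ᶠ a)
False-sym d = fromWitnessFalse (toWitnessFalse d ∘ sym)

distinct4-≡ : ∀ {k} {a b c d a′ b′ c′ d′ : Fin k} → a ≡ a′ → b ≡ b′ → c ≡ c′ → d ≡ d′ →
              Distinct4 a′ b′ c′ d′ → Distinct4 a b c d
distinct4-≡ refl refl refl refl D = D

distinct4-swap : ∀ {k} {a b c d : Fin k} → Distinct4 a b c d → Distinct4 b a c d
distinct4-swap (ab , ac , ad , bc , bd , cd) = False-sym ab , bc , bd , ac , ad , cd

data Step (s t : ℕ) : Fin s × Fin t → Fin s × Fin t → Set where
  right : ∀ {p q q′} → Succ t q q′ → Step s t (p , q) (p , q′)
  down  : ∀ {p p′ q} → Succ s p p′ → Step s t (p , q) (p′ , q)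

stepColour : ∀ {s t} {C : Set} {u v} → (ℕ → ℕ → C) → (ℕ → ℕ → C) → Step s t u v → C
stepColour colourH _ (right {p} {q} _)   = colourH (toℕ p) (toℕ q)
stepColour _ colourV (down {p} {q = q} _) = colourV (toℕ p) (toℕ q)

-- colourH P Q colours the edge from (P, Q) to (P, Q + 1), colourV P Q the edge to (P + 1, Q).
record TorusLayout (s t k : ℕ) : Set where
  field
    place             : Fin s × Fin t → ℕ
    place<            : ∀ u → place u < s * t
    place-injective   : Injective _≡_ _≡_ place
    colourH colourV   : ℕ → ℕ → Fin k
    incident-distinct : ∀ (p : Fin s) (q : Fin t) →
      Distinct4 (colourH (toℕ p) (toℕ q)) (colourH (toℕ p) (cycPred t (toℕ q)))
                (colourV (toℕ p) (toℕ q)) (colourV (cycPred s (toℕ p)) (toℕ q))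
    steps-noCross     : ∀ {u v u′ v′} (e : Step s t u v) (e′ : Step s t u′ v′) →
      Cross (place u) (place v) (place u′) (place v′) →
      stepColour colourH colourV e ≢ stepColour colourH colourV e′

data Slot : Set where
  outH inH outV inV : Slot

pick : ∀ {A : Set} → Slot → A → A → A → A → A
pick outH a _ _ _ = a
pick inH  _ b _ _ = b
pick outV _ _ c _ = c
pick inV  _ _ _ d = d

pick-injective : ∀ {k} {a b c d : Fin k} → Distinct4 a b c d → ∀ x y → pick x a b c d ≡ pick y a b c d → x ≡ y
pick-injective _ outH outH _ = refl
pick-injective _ inH  inH  _ = refl
pick-injective _ outV outV _ = refl
pick-injective _ inV  inV  _ = refl
pick-injective (ab , _) outH inH e = ⊥-elim (toWitnessFalse ab e)
pick-injective (ab , _) inH outH e = ⊥-elim (toWitnessFalse ab (sym e))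
pick-injective (_ , ac , _) outH outV e = ⊥-elim (toWitnessFalse ac e)
pick-injective (_ , ac , _) outV outH e = ⊥-elim (toWitnessFalse ac (sym e))
pick-injective (_ , _ , ad , _) outH inV e = ⊥-elim (toWitnessFalse ad e)
pick-injective (_ , _ , ad , _) inV outH e = ⊥-elim (toWitnessFalse ad (sym e))
pick-injective (_ , _ , _ , bc , _) inH outV e = ⊥-elim (toWitnessFalse bc e)
pick-injective (_ , _ , _ , bc , _) outV inH e = ⊥-elim (toWitnessFalse bc (sym e))
pick-injective (_ , _ , _ , _ , bd , _) inH inV e = ⊥-elim (toWitnessFalse bd e)
pick-injective (_ , _ , _ , _ , bd , _) inV inH e = ⊥-elim (toWitnessFalse bd (sym e))
pick-injective (_ , _ , _ , _ , _ , cd) outV inV e = ⊥-elim (toWitnessFalse cd e)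
pick-injective (_ , _ , _ , _ , _ , cd) inV outV e = ⊥-elim (toWitnessFalse cd (sym e))

module _ {s t k : ℕ} (L : TorusLayout s t k) (3≤s : 3 ≤ s) (3≤t : 3 ≤ t) where
  open TorusLayout L

  private
    V : Set
    V = Fin s × Fin t

    Adj : V → V → Set
    Adj = TorAdj s t

    2≤s : 2 ≤ s
    2≤s = ≤-trans (n≤1+n 2) 3≤s

    2≤t : 2 ≤ t
    2≤t = ≤-trans (n≤1+n 2) 3≤t

    colour : ∀ {u v} → Step s t u v → Fin k
    colour = stepColour colourH colourV

    adj⇒step : ∀ {u v} → Adj u v → Step s t u v ⊎ Step s t v u
    adj⇒step (inj₁ (refl , inj₁ sq)) = inj₁ (right sq)
    adj⇒step (inj₁ (refl , inj₂ sq)) = inj₂ (right sq)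
    adj⇒step (inj₂ (refl , inj₁ sp)) = inj₁ (down sp)
    adj⇒step (inj₂ (refl , inj₂ sp)) = inj₂ (down sp)

    edgeColour : ∀ {u v} → Adj u v → Fin k
    edgeColour e with adj⇒step e
    ... | inj₁ st = colour st
    ... | inj₂ st = colour st

    step-asym : ∀ {u v} → Step s t u v → ¬ Step s t v u
    step-asym (right sq) (right sq′) = cycSucc-asym 3≤t sq sq′
    step-asym (right sq) (down sp)   = cycSucc-irrefl 2≤s sp refl
    step-asym (down sp)  (right sq)  = cycSucc-irrefl 2≤t sq refl
    step-asym (down sp)  (down sp′)  = cycSucc-asym 3≤s sp sp′

    step-colour-unique : ∀ {u v} (e e′ : Step s t u v) → colour e ≡ colour e′
    step-colour-unique (right _)  (right _) = refl
    step-colour-unique (right sq) (down _)  = ⊥-elim (cycSucc-irrefl 2≤t sq refl)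
    step-colour-unique (down sp)  (right _) = ⊥-elim (cycSucc-irrefl 2≤s sp refl)
    step-colour-unique (down _)   (down _)  = refl

    edgeColour-symm : ∀ u v (e : Adj u v) (e′ : Adj v u) → edgeColour e ≡ edgeColour e′
    edgeColour-symm u v e e′ with adj⇒step e | adj⇒step e′
    ... | inj₁ a | inj₁ b = ⊥-elim (step-asym a b)
    ... | inj₁ a | inj₂ b = step-colour-unique a b
    ... | inj₂ a | inj₁ b = step-colour-unique a b
    ... | inj₂ a | inj₂ b = ⊥-elim (step-asym a b)

    slot : ∀ {u v} → Adj u v → Slot
    slot (inj₁ (_ , inj₁ _)) = outH
    slot (inj₁ (_ , inj₂ _)) = inH
    slot (inj₂ (_ , inj₁ _)) = outV
    slot (inj₂ (_ , inj₂ _)) = inV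

    slotColour : V → Slot → Fin k
    slotColour (p , q) x = pick x (colourH (toℕ p) (toℕ q)) (colourH (toℕ p) (cycPred t (toℕ q)))
                                  (colourV (toℕ p) (toℕ q)) (colourV (cycPred s (toℕ p)) (toℕ q))

    edgeColour≡slotColour : ∀ {u v} (e : Adj u v) → edgeColour e ≡ slotColour u (slot e)
    edgeColour≡slotColour (inj₁ (refl , inj₁ _))  = refl
    edgeColour≡slotColour {p , _} (inj₁ (refl , inj₂ sq)) = cong (colourH (toℕ p)) (cycSucc⇒cycPred sq)
    edgeColour≡slotColour (inj₂ (refl , inj₁ _))  = refl
    edgeColour≡slotColour {_ , q} (inj₂ (refl , inj₂ sp)) = cong (λ P → colourV P (toℕ q)) (cycSucc⇒cycPred sp)

    slot-injective : ∀ {u v w} (e : Adj u v) (e′ : Adj u w) → slot e ≡ slot e′ → v ≡ w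
    slot-injective {p , _} {_ , q₁} {_ , q₂} (inj₁ (refl , inj₁ s₁)) (inj₁ (refl , inj₁ s₂)) _ =
      cong (p ,_) (toℕ-injective (cycSucc-functional (toℕ<n q₁) (toℕ<n q₂) s₁ s₂))
    slot-injective {p , _} (inj₁ (refl , inj₂ s₁)) (inj₁ (refl , inj₂ s₂)) _ =
      cong (p ,_) (toℕ-injective (trans (cycSucc⇒cycPred s₁) (sym (cycSucc⇒cycPred s₂))))
    slot-injective {_ , q} {p₁ , _} {p₂ , _} (inj₂ (refl , inj₁ s₁)) (inj₂ (refl , inj₁ s₂)) _ =
      cong (_, q) (toℕ-injective (cycSucc-functional (toℕ<n p₁) (toℕ<n p₂) s₁ s₂))
    slot-injective {_ , q} (inj₂ (refl , inj₂ s₁)) (inj₂ (refl , inj₂ s₂)) _ =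
      cong (_, q) (toℕ-injective (trans (cycSucc⇒cycPred s₁) (sym (cycSucc⇒cycPred s₂))))
    slot-injective (inj₁ (_ , inj₁ _)) (inj₁ (_ , inj₂ _)) ()
    slot-injective (inj₁ (_ , inj₁ _)) (inj₂ (_ , inj₁ _)) ()
    slot-injective (inj₁ (_ , inj₁ _)) (inj₂ (_ , inj₂ _)) ()
    slot-injective (inj₁ (_ , inj₂ _)) (inj₁ (_ , inj₁ _)) ()
    slot-injective (inj₁ (_ , inj₂ _)) (inj₂ (_ , inj₁ _)) ()
    slot-injective (inj₁ (_ , inj₂ _)) (inj₂ (_ , inj₂ _)) ()
    slot-injective (inj₂ (_ , inj₁ _)) (inj₁ (_ , inj₁ _)) ()
    slot-injective (inj₂ (_ , inj₁ _)) (inj₁ (_ , inj₂ _)) ()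
    slot-injective (inj₂ (_ , inj₁ _)) (inj₂ (_ , inj₂ _)) ()
    slot-injective (inj₂ (_ , inj₂ _)) (inj₁ (_ , inj₁ _)) ()
    slot-injective (inj₂ (_ , inj₂ _)) (inj₁ (_ , inj₂ _)) ()
    slot-injective (inj₂ (_ , inj₂ _)) (inj₂ (_ , inj₁ _)) ()

    edgeColour-proper : ∀ u v w (e : Adj u v) (e′ : Adj u w) → v ≢ w → edgeColour e ≢ edgeColour e′
    edgeColour-proper u@(p , q) v w e e′ v≢w eq = v≢w (slot-injective e e′ (pick-injective (incident-distinct p q) (slot e) (slot e′)
      (trans (sym (edgeColour≡slotColour e)) (trans eq (edgeColour≡slotColour e′)))))

    edgeColour-noCross : ∀ a b c d (e : Adj a b) (e′ : Adj c d) →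
                         Cross (place a) (place b) (place c) (place d) → edgeColour e ≢ edgeColour e′
    edgeColour-noCross a b c d e e′ cr with adj⇒step e | adj⇒step e′
    ... | inj₁ x | inj₁ y = steps-noCross x y cr
    ... | inj₁ x | inj₂ y = steps-noCross x y (cross-swapʳ cr)
    ... | inj₂ x | inj₁ y = steps-noCross x y (cross-swapˡ cr)
    ... | inj₂ x | inj₂ y = steps-noCross x y (cross-swapˡ (cross-swapʳ cr))

    placement : V → Fin (s * t)
    placement u = fromℕ< (place< u)

    toℕ-placement : ∀ u → toℕ (placement u) ≡ place u
    toℕ-placement u = toℕ-fromℕ< (place< u)

    ψ : V ⤖ Fin (s * t)
    ψ = injective⇒bijection placement refl
          (λ {u} {v} e → place-injective (trans (sym (toℕ-placement u)) (trans (cong toℕ e) (toℕ-placement v))))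

  layout⇒embedding : MatchingBookEmbedding (Torus s t) (s * t) k
  layout⇒embedding = record
    { ψ       = ψ
    ; colour  = λ _ _ → edgeColour
    ; symm    = edgeColour-symm
    ; proper  = edgeColour-proper
    ; noCross = λ a b c d e e′ cr → edgeColour-noCross a b c d e e′
        (subst₂ (λ x y → Cross x y _ _) (toℕ-placement a) (toℕ-placement b)
          (subst₂ (Cross _ _) (toℕ-placement c) (toℕ-placement d) cr))
    }

-- The layout

Colour : Set
Colour = Fin 5

pattern cA = fzero
pattern cB = fsuc fzero
pattern cC = fsuc (fsuc fzero)
pattern cD = fsuc (fsuc (fsuc fzero))
pattern cE = fsuc (fsuc (fsuc (fsuc fzero)))

odd : ℕ → Bool
odd zero    = false
odd (suc n) = not (odd n)

odd-double : ∀ n → odd (n + n) ≡ false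
odd-double zero = refl
odd-double (suc n) rewrite +-suc n n | odd-double n = refl

-- Distinct4 of four distinct literal colours reduces to this.
distinct-literals : ⊤ × ⊤ × ⊤ × ⊤ × ⊤ × ⊤
distinct-literals = tt , tt , tt , tt , tt , tt

ABC : Colour → Set
ABC c = False (c ≟ᶠ cD) × False (c ≟ᶠ cE)

odd-pred : ∀ {n b} → odd (suc n) ≡ b → odd n ≡ not b
odd-pred {n} e = trans (sym (not-involutive (odd n))) (cong not e)

odd-dichotomy : ∀ n → odd n ≡ true ⊎ odd n ≡ false
odd-dichotomy n with odd n
... | true  = inj₁ refl
... | false = inj₂ refl

double-< : ∀ {x y} → x < y → suc (x + x) ≤ y + y
double-< {x} {y} l = ≤-trans (+-monoʳ-≤ (suc x) (<⇒≤ l)) (+-monoˡ-≤ y l)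

NearDouble : (ℕ → ℕ) → Set
NearDouble f = ∀ x → x + x ≤ f x × f x ≤ suc (x + x)

bit : Bool → ℕ
bit true  = 1
bit false = 0

nearDouble-bit : ∀ (b : ℕ → Bool) → NearDouble (λ x → x + x + bit (b x))
nearDouble-bit b x = m≤m+n (x + x) _ , subst (x + x + bit (b x) ≤_) (+-comm (x + x) 1) (+-monoʳ-≤ (x + x) (bit≤1 (b x)))
  where bit≤1 : ∀ c → bit c ≤ 1
        bit≤1 true  = ≤-refl
        bit≤1 false = z≤n

nearDouble-mono : ∀ {f} → NearDouble f → ∀ {x y} → x ≤ y → f x ≤ f y
nearDouble-mono nd {x} {y} l with m≤n⇒m<n∨m≡n l
... | inj₁ x<y  = ≤-trans (proj₂ (nd x)) (≤-trans (double-< x<y) (proj₁ (nd y)))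
... | inj₂ refl = ≤-refl

double-<-strict : ∀ {x y} → x < y → 2 + (x + x) ≤ y + y
double-<-strict {x} x<y = ≤-trans (≤-reflexive (sym (cong suc (+-suc x x)))) (+-mono-≤ x<y x<y)

nearDouble-injective : ∀ {f g} → NearDouble f → NearDouble g → ∀ {x y} → f x ≡ g y → x ≡ y
nearDouble-injective {f} {g} nf ng {x} {y} e with <-cmp x y
... | tri< x<y _ _ = ⊥-elim (<⇒≢ (≤-trans (s≤s (proj₂ (nf x))) (≤-trans (double-<-strict x<y) (proj₁ (ng y)))) e)
... | tri≈ _ x≡y _ = x≡y
... | tri> _ _ y<x = ⊥-elim (<⇒≢ (≤-trans (s≤s (proj₂ (ng y))) (≤-trans (double-<-strict y<x) (proj₁ (nf x)))) (sym e))

*+-injective : ∀ {n} a a′ {x x′} → x < n → x′ < n → a * n + x ≡ a′ * n + x′ → a ≡ a′ × x ≡ x′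
*+-injective zero    zero     _  _  e = refl , e
*+-injective {n} zero (suc a′) {x′ = x′} x<n _ e =
  ⊥-elim (<⇒≱ x<n (≤-trans (m≤m+n n (a′ * n + x′)) (≤-reflexive (trans (sym (+-assoc n (a′ * n) x′)) (sym e)))))
*+-injective {n} (suc a) zero {x} _ x′<n e =
  ⊥-elim (<⇒≱ x′<n (≤-trans (m≤m+n n (a * n + x)) (≤-reflexive (trans (sym (+-assoc n (a * n) x)) e))))
*+-injective {n} (suc a) (suc a′) {x} {x′} x<n x′<n e
  with refl , x≡x′ ← *+-injective a a′ x<n x′<n (+-cancelˡ-≡ n _ _ (trans (sym (+-assoc n (a * n) x)) (trans e (+-assoc n (a′ * n) x′))))
  = refl , x≡x′

module Construction (a b : ℕ) where

  h : ℕ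
  h = 3 + a

  top : ℕ
  top = h + h

  top⁻ : ℕ
  top⁻ = pred top

  t : ℕ
  t = suc top

  k : ℕ
  k = 2 + b

  m : ℕ
  m = suc (k + k)

  s : ℕ
  s = suc (suc m)

  alt : ℕ → Colour
  alt q = if odd q then cD else cE

  band : ℕ → Colour
  band P = if odd P then cC else cB

  legColour : ℕ → Colour
  legColour zero    = cC
  legColour (suc q) = if does (suc q ≟ top⁻) then cB else alt (suc q)

  rungColour : ℕ → Colour
  rungColour zero          = cA
  rungColour (suc zero)    = cE
  rungColour q@(suc (suc _)) =
    if does (q <? h) then cC else
    if does (q ≟ h) then cA else
    if does (q <? top⁻) then cB else
    if does (q ≟ top⁻) then cD else cA

  wrapColour : ℕ → Colour
  wrapColour P = if does (P ≟ m) then cD else cE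

  runColour : ℕ → ℕ → Colour
  runColour P zero    = band (suc P)
  runColour P (suc i) = alt (suc i)

  lastRunColour : ℕ → Colour
  lastRunColour zero    = cB
  lastRunColour (suc i) = if does (suc i ≟ top⁻) then cC else alt (suc (suc i))

  blockColour : ℕ → ℕ → Colour
  blockColour P i = if does (P ≟ m) then lastRunColour i else runColour P i

  rank : ℕ → ℕ → ℕ
  rank P q = if odd P then pred (top ∸ q) else q

  colourH : ℕ → ℕ → Colour
  colourH zero q    = if does (q ≟ top) then cE else legColour q
  colourH (suc p) q =
    if does (p ≟ m) then (if does (q ≟ top) then cD else legColour q)
    else if does (q ≟ top) then wrapColour (suc p) else blockColour (suc p) (rank (suc p) q)

  bridge₀Colour : ℕ → Colour
  bridge₀Colour P = if does (P ≟ 0) then cD else if does (P ≟ m) then cE else cA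

  bridgeColour : ℕ → ℕ → Colour
  bridgeColour P j = if does (h ≤? j) then band P else if does (j ≟ 0) then bridge₀Colour P else cA

  -- The bridge from (P, q) to (P + 1, q) has index j = bridgeIndex P q: it leaves a middle column P
  -- at offset top ∸ j and enters a middle column P + 1 at offset j.
  bridgeIndex : ℕ → ℕ → ℕ
  bridgeIndex P q = if odd P then q else top ∸ q

  colourV : ℕ → ℕ → Colour
  colourV P q = if does (P ≟ suc m) then rungColour q else bridgeColour P (bridgeIndex P q)

  offset : ℕ → ℕ → ℕ
  offset P q = if odd P then top ∸ q else q

  pos₀ : ℕ → ℕ
  pos₀ q = q + q + bit (not (odd q))

  posₗ : ℕ → ℕ
  posₗ q = q + q + bit (odd q)

  pos : ℕ → ℕ → ℕ
  pos zero q    = pos₀ q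
  pos (suc p) q = if does (p ≟ m) then posₗ q else suc (suc p) * t + offset (suc p) q

  h<top⁻ : h < top⁻
  h<top⁻ = s≤s (s≤s (≤-trans (n≤1+n _) (m≤n+m h a)))

  h<top : h < top
  h<top = <-trans h<top⁻ (n<1+n top⁻)

  top⁻≢top : top⁻ ≢ top
  top⁻≢top = <⇒≢ (n<1+n top⁻)

  <top⁻⇒≢top : ∀ {q} → q < top⁻ → q ≢ top
  <top⁻⇒≢top l = <⇒≢ (<-trans l (n<1+n top⁻))

  top∸h : top ∸ h ≡ h
  top∸h = m+n∸m≡n h h

  odd-top : odd top ≡ false
  odd-top = odd-double h

  odd-top⁻ : odd top⁻ ≡ true
  odd-top⁻ = odd-pred {top⁻} odd-top

  odd-m : odd m ≡ true
  odd-m = cong not (odd-double k)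

  top∸top⁻ : top ∸ top⁻ ≡ 1
  top∸top⁻ = trans (cong (_∸ top⁻) (+-comm 1 top⁻)) (m+n∸m≡n top⁻ 1)

  alt-pred-top⁻ : alt (pred top⁻) ≡ cE
  alt-pred-top⁻ with odd (pred top⁻) | odd-top⁻
  ... | false | _ = refl

  legColour-top⁻ : legColour top⁻ ≡ cB
  legColour-top⁻ rewrite dec-true (top⁻ ≟ top⁻) refl = refl

  legColour-interior : ∀ {q} → 1 ≤ q → q < top⁻ → legColour q ≡ alt q
  legColour-interior {suc q} _ l rewrite dec-false (suc q ≟ top⁻) (<⇒≢ l) = refl

  rungColour-low : ∀ {q} → 2 ≤ q → q < h → rungColour q ≡ cC
  rungColour-low {suc zero} (s≤s ()) _
  rungColour-low {suc (suc q)} _ l rewrite dec-true (suc (suc q) <? h) l = refl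

  rungColour-h : rungColour h ≡ cA
  rungColour-h rewrite dec-false (h <? h) (n≮n h) | dec-true (h ≟ h) refl = refl

  rungColour-high : ∀ {q} → h < q → q < top⁻ → rungColour q ≡ cB
  rungColour-high {suc zero} (s≤s ()) _
  rungColour-high {suc (suc q)} l l′
    rewrite dec-false (suc (suc q) <? h) (<⇒≯ l) | dec-false (suc (suc q) ≟ h) (>⇒≢ l)
          | dec-true (suc (suc q) <? top⁻) l′ = refl

  rungColour-top⁻ : rungColour top⁻ ≡ cD
  rungColour-top⁻
    rewrite dec-false (top⁻ <? h) (<⇒≯ h<top⁻) | dec-false (top⁻ ≟ h) (>⇒≢ h<top⁻)
          | dec-false (top⁻ <? top⁻) (n≮n top⁻) | dec-true (top⁻ ≟ top⁻) refl = refl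

  rungColour-top : rungColour top ≡ cA
  rungColour-top
    rewrite dec-false (top <? h) (<⇒≯ h<top) | dec-false (top ≟ h) (>⇒≢ h<top)
          | dec-false (top <? top⁻) (<⇒≯ (n<1+n top⁻)) | dec-false (top ≟ top⁻) (>⇒≢ (n<1+n top⁻)) = refl

  colourV-rung : ∀ q → colourV (suc m) q ≡ rungColour q
  colourV-rung q rewrite dec-true (suc m ≟ suc m) refl = refl

  colourV-bridge : ∀ {P} q → P ≢ suc m → colourV P q ≡ bridgeColour P (bridgeIndex P q)
  colourV-bridge {P} q ne rewrite dec-false (P ≟ suc m) ne = refl

  colourV-m : ∀ q → colourV m q ≡ bridgeColour m q
  colourV-m q rewrite colourV-bridge {m} q (<⇒≢ (n<1+n m)) | odd-m = refl

  bridgeColour-high : ∀ P j → h ≤ j → bridgeColour P j ≡ band P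
  bridgeColour-high P j l rewrite dec-true (h ≤? j) l = refl

  bridgeColour-low : ∀ P j → 1 ≤ j → j < h → bridgeColour P j ≡ cA
  bridgeColour-low P (suc j) _ l rewrite dec-false (h ≤? suc j) (<⇒≱ l) = refl

  bridge₀Colour-m : bridge₀Colour m ≡ cE
  bridge₀Colour-m rewrite dec-true (m ≟ m) refl = refl

  bridge₀Colour-middle : ∀ {P} → P ≢ 0 → P ≢ m → bridge₀Colour P ≡ cA
  bridge₀Colour-middle {P} n0 nm rewrite dec-false (P ≟ 0) n0 | dec-false (P ≟ m) nm = refl

  band-odd : ∀ P → odd P ≡ true → band P ≡ cC
  band-odd _ isOdd rewrite isOdd = refl

  band-even : ∀ P → odd P ≡ false → band P ≡ cB
  band-even _ isEven rewrite isEven = refl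

  band-m : band m ≡ cC
  band-m = band-odd m odd-m

  colourH₀-top : colourH 0 top ≡ cE
  colourH₀-top rewrite dec-true (top ≟ top) refl = refl

  colourH₀ : ∀ {q} → q ≢ top → colourH 0 q ≡ legColour q
  colourH₀ {q} ne rewrite dec-false (q ≟ top) ne = refl

  colourHₗ-top : colourH (suc m) top ≡ cD
  colourHₗ-top rewrite dec-true (m ≟ m) refl | dec-true (top ≟ top) refl = refl

  colourHₗ : ∀ {q} → q ≢ top → colourH (suc m) q ≡ legColour q
  colourHₗ {q} ne rewrite dec-true (m ≟ m) refl | dec-false (q ≟ top) ne = refl

  colourH-wrap : ∀ {p} → p ≢ m → colourH (suc p) top ≡ wrapColour (suc p)
  colourH-wrap {p} ne rewrite dec-false (p ≟ m) ne | dec-true (top ≟ top) refl = refl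

  colourH-run : ∀ {p q} → p ≢ m → q ≢ top → colourH (suc p) q ≡ blockColour (suc p) (rank (suc p) q)
  colourH-run {p} {q} ne ne′ rewrite dec-false (p ≟ m) ne | dec-false (q ≟ top) ne′ = refl

  wrapColour-m : wrapColour m ≡ cD
  wrapColour-m rewrite dec-true (m ≟ m) refl = refl

  wrapColour-middle : ∀ {P} → P ≢ m → wrapColour P ≡ cE
  wrapColour-middle {P} ne rewrite dec-false (P ≟ m) ne = refl

  blockColour-m : ∀ i → blockColour m i ≡ lastRunColour i
  blockColour-m i rewrite dec-true (m ≟ m) refl = refl

  blockColour-middle : ∀ {P} i → P ≢ m → blockColour P i ≡ runColour P i
  blockColour-middle {P} i ne rewrite dec-false (P ≟ m) ne = refl

  lastRunColour-top⁻ : lastRunColour top⁻ ≡ cC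
  lastRunColour-top⁻ rewrite dec-true (top⁻ ≟ top⁻) refl = refl

  lastRunColour-interior : ∀ i → suc i < top⁻ → lastRunColour (suc i) ≡ alt (suc (suc i))
  lastRunColour-interior i l rewrite dec-false (suc i ≟ top⁻) (<⇒≢ l) = refl

  alt-distinct : ∀ q {c d} → False (c ≟ᶠ d) → ABC c → ABC d → Distinct4 (alt (suc q)) (alt q) c d
  alt-distinct q c≢d (c≢D , c≢E) (d≢D , d≢E) with odd q
  ... | true  = tt , False-sym c≢E , False-sym d≢E , False-sym c≢D , False-sym d≢D , c≢d
  ... | false = tt , False-sym c≢D , False-sym d≢D , False-sym c≢E , False-sym d≢E , c≢d

  data Row : ℕ → Set where
    row₀    : Row 0
    row₁    : Row 1
    rowLow  : ∀ q → 1 ≤ q → suc q < h → Row (suc q)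
    rowH    : Row h
    rowHigh : ∀ q → h ≤ q → suc q < top⁻ → Row (suc q)
    row⁻    : Row top⁻
    rowTop  : Row top

  row : ∀ q → q ≤ top → Row q
  row zero          _ = row₀
  row (suc zero)    _ = row₁
  row (suc (suc q)) l with <-cmp (suc (suc q)) h
  ... | tri< x _ _    = rowLow (suc q) (s≤s z≤n) x
  ... | tri≈ _ refl _ = rowH
  ... | tri> _ _ x with <-cmp (suc (suc q)) top⁻
  ...   | tri< y _ _ = rowHigh (suc q) (s≤s⁻¹ x) y
  ...   | tri≈ _ e _ = subst Row (sym e) row⁻
  ...   | tri> _ _ y = subst Row (sym (≤-antisym l y)) rowTop

  h≤top∸low : ∀ {q} → q ≤ h → h ≤ top ∸ q
  h≤top∸low l = ≤-trans (≤-reflexive (sym top∸h)) (∸-monoʳ-≤ top l)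

  top∸high : ∀ {q} → h < q → q < top → 1 ≤ top ∸ q × top ∸ q < h
  top∸high {q} h<q q<top = m<n⇒0<n∸m q<top , subst (top ∸ q <_) top∸h (∸-monoʳ-< h<q (<⇒≤ q<top))

  interiorLegs : ∀ P {q c d} → (∀ {x} → x ≢ top → colourH P x ≡ legColour x) → 1 ≤ q → suc q < top⁻ →
                 False (c ≟ᶠ d) → ABC c → ABC d → Distinct4 (colourH P (suc q)) (colourH P q) c d
  interiorLegs P {q} leg 1≤q l c≢d c∈ d∈ =
    distinct4-≡ (trans (leg (<top⁻⇒≢top l)) (legColour-interior (s≤s z≤n) l))
                (trans (leg (<top⁻⇒≢top l′)) (legColour-interior 1≤q l′)) refl refl
                (alt-distinct q c≢d c∈ d∈)
    where l′ : q < top⁻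
          l′ = <-trans (n<1+n q) l

  low<top⁻ : ∀ {q} → suc q < h → suc q < top⁻
  low<top⁻ l = <-trans l h<top⁻

  vertex₀ : ∀ {Q} → Row Q → Distinct4 (colourH 0 Q) (colourH 0 (cycPred t Q)) (colourV 0 Q) (colourV (suc m) Q)
  vertex₀ row₀ = distinct4-≡ refl colourH₀-top (bridgeColour-high 0 _ (<⇒≤ h<top)) (colourV-rung 0) distinct-literals
  vertex₀ row₁ = distinct4-≡ refl refl (bridgeColour-high 0 _ (<⇒≤ h<top⁻)) (colourV-rung 1) distinct-literals
  vertex₀ (rowLow q 1≤q l) =
    distinct4-≡ refl refl (bridgeColour-high 0 _ (h≤top∸low (<⇒≤ l)))
                (trans (colourV-rung _) (rungColour-low (s≤s 1≤q) l))
                (interiorLegs 0 colourH₀ 1≤q (low<top⁻ l) tt (tt , tt) (tt , tt))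
  vertex₀ rowH =
    distinct4-≡ refl refl (bridgeColour-high 0 _ (≤-reflexive (sym top∸h))) (trans (colourV-rung h) rungColour-h)
                (interiorLegs 0 colourH₀ (s≤s z≤n) h<top⁻ tt (tt , tt) (tt , tt))
  vertex₀ (rowHigh q h≤q l) =
    distinct4-≡ refl refl (uncurry (bridgeColour-low 0 _) (top∸high (s≤s h≤q) (<-trans l (n<1+n top⁻))))
                (trans (colourV-rung _) (rungColour-high (s≤s h≤q) l))
                (interiorLegs 0 colourH₀ (≤-trans (s≤s z≤n) h≤q) l tt (tt , tt) (tt , tt))
  vertex₀ row⁻ =
    distinct4-≡ (trans (colourH₀ top⁻≢top) legColour-top⁻)
                (trans (colourH₀ (<top⁻⇒≢top (n<1+n _))) (trans (legColour-interior (s≤s z≤n) (n<1+n _)) alt-pred-top⁻))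
                (trans (cong (bridgeColour 0) top∸top⁻) (bridgeColour-low 0 _ ≤-refl (s≤s (s≤s z≤n))))
                (trans (colourV-rung top⁻) rungColour-top⁻) distinct-literals
  vertex₀ rowTop =
    distinct4-≡ colourH₀-top (trans (colourH₀ top⁻≢top) legColour-top⁻)
                (cong (bridgeColour 0) (n∸n≡0 top)) (trans (colourV-rung top) rungColour-top) distinct-literals

  vertexₗ : ∀ {Q} → Row Q → Distinct4 (colourH (suc m) Q) (colourH (suc m) (cycPred t Q)) (colourV (suc m) Q) (colourV m Q)
  vertexₗ row₀ = distinct4-≡ (colourHₗ {0} (λ ())) colourHₗ-top (colourV-rung 0) (trans (colourV-m 0) bridge₀Colour-m)
                             distinct-literals
  vertexₗ row₁ = distinct4-≡ (colourHₗ {1} (λ ())) (colourHₗ {0} (λ ())) (colourV-rung 1)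
                             (trans (colourV-m 1) (bridgeColour-low m _ ≤-refl (s≤s (s≤s z≤n)))) distinct-literals
  vertexₗ (rowLow q 1≤q l) =
    distinct4-≡ refl refl (trans (colourV-rung _) (rungColour-low (s≤s 1≤q) l))
                (trans (colourV-m _) (bridgeColour-low m _ (s≤s z≤n) l))
                (interiorLegs (suc m) colourHₗ 1≤q (low<top⁻ l) tt (tt , tt) (tt , tt))
  vertexₗ rowH =
    distinct4-≡ refl refl (trans (colourV-rung h) rungColour-h)
                (trans (colourV-m h) (trans (bridgeColour-high m _ ≤-refl) band-m))
                (interiorLegs (suc m) colourHₗ (s≤s z≤n) h<top⁻ tt (tt , tt) (tt , tt))
  vertexₗ (rowHigh q h≤q l) =
    distinct4-≡ refl refl (trans (colourV-rung _) (rungColour-high (s≤s h≤q) l))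
                (trans (colourV-m _) (trans (bridgeColour-high m _ (≤-trans h≤q (n≤1+n q))) band-m))
                (interiorLegs (suc m) colourHₗ (≤-trans (s≤s z≤n) h≤q) l tt (tt , tt) (tt , tt))
  vertexₗ row⁻ =
    distinct4-≡ (trans (colourHₗ top⁻≢top) legColour-top⁻)
                (trans (colourHₗ (<top⁻⇒≢top (n<1+n _))) (trans (legColour-interior (s≤s z≤n) (n<1+n _)) alt-pred-top⁻))
                (trans (colourV-rung top⁻) rungColour-top⁻)
                (trans (colourV-m top⁻) (trans (bridgeColour-high m _ (<⇒≤ h<top⁻)) band-m)) distinct-literals
  vertexₗ rowTop =
    distinct4-≡ colourHₗ-top (trans (colourHₗ top⁻≢top) legColour-top⁻) (trans (colourV-rung top) rungColour-top)
                (trans (colourV-m top) (trans (bridgeColour-high m _ (<⇒≤ h<top)) band-m)) distinct-literals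

  band-elim : (Pr : Colour → Set) → Pr cB → Pr cC → ∀ P → Pr (band P)
  band-elim Pr b c P with odd P
  ... | true  = c
  ... | false = b

  bands-elim : (Pr : Colour → Colour → Set) → Pr cC cB → Pr cB cC → ∀ P → Pr (band (suc P)) (band P)
  bands-elim Pr cb bc P with odd P
  ... | true  = bc
  ... | false = cb

  band-ABC : ∀ P → ABC (band P)
  band-ABC = band-elim ABC (tt , tt) (tt , tt)

  band≢A : ∀ P → False (band P ≟ᶠ cA)
  band≢A = band-elim (λ c → False (c ≟ᶠ cA)) tt tt

  band-alternates : ∀ P → False (band (suc P) ≟ᶠ band P)
  band-alternates = bands-elim (λ c d → False (c ≟ᶠ d)) tt tt

  band-kk : band (k + k) ≡ cB
  band-kk = band-even (k + k) (odd-double k)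

  alt-top⁻ : alt top⁻ ≡ cD
  alt-top⁻ rewrite odd-top⁻ = refl

  -- In a middle column, the vertex at offset o is followed by the run edge of rank o and preceded
  -- by that of rank o − 1; the run edge of rank top is the wrap-around edge.
  edgeAt : ℕ → ℕ → Colour
  edgeAt P o = if does (o ≟ top) then wrapColour P else blockColour P o

  edgeBefore : ℕ → ℕ → Colour
  edgeBefore P zero    = wrapColour P
  edgeBefore P (suc o) = blockColour P o

  edgeAt-top : ∀ P → edgeAt P top ≡ wrapColour P
  edgeAt-top P rewrite dec-true (top ≟ top) refl = refl

  edgeAt-run : ∀ P o → o ≢ top → edgeAt P o ≡ blockColour P o
  edgeAt-run P o ne rewrite dec-false (o ≟ top) ne = refl

  vertexRun : ∀ p {o} → suc p < m → Row o →
              Distinct4 (edgeAt (suc p) o) (edgeBefore (suc p) o) (bridgeColour (suc p) (top ∸ o)) (bridgeColour p o)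
  vertexRun p P<m row₀ with p ≟ 0
  ... | yes refl =
    distinct4-≡ (trans (edgeAt-run 1 0 (λ ())) (blockColour-middle 0 (<⇒≢ P<m))) (wrapColour-middle (<⇒≢ P<m))
                (bridgeColour-high 1 _ (<⇒≤ h<top)) refl distinct-literals
  ... | no p≢0 =
    distinct4-≡ (trans (edgeAt-run (suc p) 0 (λ ())) (blockColour-middle 0 (<⇒≢ P<m))) (wrapColour-middle (<⇒≢ P<m))
                (bridgeColour-high (suc p) _ (<⇒≤ h<top)) (bridge₀Colour-middle p≢0 (<⇒≢ (<-trans (n<1+n p) P<m)))
                (bands-elim (λ x y → Distinct4 x cE y cA) distinct-literals distinct-literals (suc p))
  vertexRun p P<m row₁ =
    distinct4-≡ (trans (edgeAt-run (suc p) 1 (λ ())) (blockColour-middle 1 (<⇒≢ P<m))) (blockColour-middle 0 (<⇒≢ P<m))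
                (bridgeColour-high (suc p) _ (<⇒≤ h<top⁻)) (bridgeColour-low p _ ≤-refl (s≤s (s≤s z≤n)))
                (bands-elim (λ x y → Distinct4 cD x y cA) distinct-literals distinct-literals (suc p))
  vertexRun p P<m (rowLow (suc q) _ l) =
    distinct4-≡ (trans (edgeAt-run (suc p) _ (<top⁻⇒≢top (low<top⁻ l))) (blockColour-middle (suc (suc q)) (<⇒≢ P<m)))
                (blockColour-middle (suc q) (<⇒≢ P<m))
                (bridgeColour-high (suc p) _ (h≤top∸low (<⇒≤ l))) (bridgeColour-low p _ (s≤s z≤n) l)
                (alt-distinct (suc q) (band≢A (suc p)) (band-ABC (suc p)) (tt , tt))
  vertexRun p P<m rowH =
    distinct4-≡ (trans (edgeAt-run (suc p) h (<⇒≢ h<top)) (blockColour-middle h (<⇒≢ P<m)))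
                (blockColour-middle (2 + a) (<⇒≢ P<m))
                (bridgeColour-high (suc p) _ (≤-reflexive (sym top∸h))) (bridgeColour-high p _ ≤-refl)
                (alt-distinct (2 + a) (band-alternates p) (band-ABC (suc p)) (band-ABC p))
  vertexRun p P<m (rowHigh (suc q) h≤q l) =
    distinct4-≡ (trans (edgeAt-run (suc p) _ (<top⁻⇒≢top l)) (blockColour-middle (suc (suc q)) (<⇒≢ P<m)))
                (blockColour-middle (suc q) (<⇒≢ P<m))
                (uncurry (bridgeColour-low (suc p) _) (top∸high (s≤s h≤q) (<-trans l (n<1+n top⁻))))
                (bridgeColour-high p _ (≤-trans h≤q (n≤1+n _)))
                (alt-distinct (suc q) (False-sym (band≢A p)) (tt , tt) (band-ABC p))
  vertexRun p P<m row⁻ =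
    distinct4-≡ (trans (edgeAt-run (suc p) top⁻ top⁻≢top) (trans (blockColour-middle top⁻ (<⇒≢ P<m)) alt-top⁻))
                (trans (blockColour-middle (pred top⁻) (<⇒≢ P<m)) alt-pred-top⁻)
                (trans (cong (bridgeColour (suc p)) top∸top⁻) (bridgeColour-low (suc p) 1 ≤-refl (s≤s (s≤s z≤n))))
                (bridgeColour-high p _ (<⇒≤ h<top⁻))
                (band-elim (Distinct4 cD cE cA) distinct-literals distinct-literals p)
  vertexRun p P<m rowTop =
    distinct4-≡ (trans (edgeAt-top (suc p)) (wrapColour-middle (<⇒≢ P<m)))
                (trans (blockColour-middle top⁻ (<⇒≢ P<m)) alt-top⁻)
                (trans (cong (bridgeColour (suc p)) (n∸n≡0 top)) (bridge₀Colour-middle (λ ()) (<⇒≢ P<m)))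
                (bridgeColour-high p _ (<⇒≤ h<top))
                (band-elim (Distinct4 cE cD cA) distinct-literals distinct-literals p)

  kk≢m : k + k ≢ m
  kk≢m = <⇒≢ (n<1+n (k + k))

  vertexLastRun : ∀ {o} → Row o →
                  Distinct4 (edgeAt m o) (edgeBefore m o) (bridgeColour m (top ∸ o)) (bridgeColour (k + k) o)
  vertexLastRun row₀ =
    distinct4-≡ (trans (edgeAt-run m 0 (λ ())) (blockColour-m 0)) wrapColour-m
                (trans (bridgeColour-high m _ (<⇒≤ h<top)) band-m) (bridge₀Colour-middle (λ ()) kk≢m) distinct-literals
  vertexLastRun row₁ =
    distinct4-≡ (trans (edgeAt-run m 1 (λ ())) (trans (blockColour-m 1) (lastRunColour-interior 0 (s≤s (s≤s z≤n)))))
                (blockColour-m 0)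
                (trans (bridgeColour-high m _ (<⇒≤ h<top⁻)) band-m)
                (bridgeColour-low (k + k) 1 ≤-refl (s≤s (s≤s z≤n))) distinct-literals
  vertexLastRun (rowLow (suc q) _ l) =
    distinct4-≡ (trans (edgeAt-run m (suc (suc q)) (<top⁻⇒≢top (low<top⁻ l)))
                       (trans (blockColour-m (suc (suc q))) (lastRunColour-interior (suc q) (low<top⁻ l))))
                (trans (blockColour-m (suc q)) (lastRunColour-interior q (<-trans (n<1+n _) (low<top⁻ l))))
                (trans (bridgeColour-high m _ (h≤top∸low (<⇒≤ l))) band-m)
                (bridgeColour-low (k + k) _ (s≤s z≤n) l)
                (alt-distinct (suc (suc q)) tt (tt , tt) (tt , tt))
  vertexLastRun rowH =
    distinct4-≡ (trans (edgeAt-run m h (<⇒≢ h<top)) (trans (blockColour-m h) (lastRunColour-interior (2 + a) h<top⁻)))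
                (trans (blockColour-m (2 + a)) (lastRunColour-interior (suc a) (<-trans (n<1+n _) h<top⁻)))
                (trans (bridgeColour-high m _ (≤-reflexive (sym top∸h))) band-m)
                (trans (bridgeColour-high (k + k) h ≤-refl) band-kk)
                (alt-distinct h tt (tt , tt) (tt , tt))
  vertexLastRun (rowHigh (suc q) h≤q l) =
    distinct4-≡ (trans (edgeAt-run m (suc (suc q)) (<top⁻⇒≢top l)) (trans (blockColour-m (suc (suc q))) (lastRunColour-interior (suc q) l)))
                (trans (blockColour-m (suc q)) (lastRunColour-interior q (<-trans (n<1+n _) l)))
                (uncurry (bridgeColour-low m _) (top∸high (s≤s h≤q) (<-trans l (n<1+n top⁻))))
                (trans (bridgeColour-high (k + k) _ (≤-trans h≤q (n≤1+n _))) band-kk)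
                (alt-distinct (suc (suc q)) tt (tt , tt) (tt , tt))
  vertexLastRun row⁻ =
    distinct4-≡ (trans (edgeAt-run m top⁻ top⁻≢top) (trans (blockColour-m top⁻) lastRunColour-top⁻))
                (trans (blockColour-m (pred top⁻)) (trans (lastRunColour-interior _ (n<1+n _)) alt-top⁻))
                (trans (cong (bridgeColour m) top∸top⁻) (bridgeColour-low m 1 ≤-refl (s≤s (s≤s z≤n))))
                (trans (bridgeColour-high (k + k) top⁻ (<⇒≤ h<top⁻)) band-kk) distinct-literals
  vertexLastRun rowTop =
    distinct4-≡ (trans (edgeAt-top m) wrapColour-m) (trans (blockColour-m top⁻) lastRunColour-top⁻)
                (trans (cong (bridgeColour m) (n∸n≡0 top)) bridge₀Colour-m)
                (trans (bridgeColour-high (k + k) top (<⇒≤ h<top)) band-kk) distinct-literals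

  vertexColumn : ∀ p {o} → suc p ≤ m → Row o →
                 Distinct4 (edgeAt (suc p) o) (edgeBefore (suc p) o) (bridgeColour (suc p) (top ∸ o)) (bridgeColour p o)
  vertexColumn p P≤m with m≤n⇒m<n∨m≡n P≤m
  ... | inj₁ P<m = vertexRun p P<m
  ... | inj₂ P≡m with suc-injective P≡m
  ...   | refl = vertexLastRun

  colourH-even-out : ∀ {p} Q → odd (suc p) ≡ false → p ≢ m → colourH (suc p) Q ≡ edgeAt (suc p) Q
  colourH-even-out {p} Q isEven p≢m with Q ≟ top
  ... | yes refl rewrite colourH-wrap p≢m | edgeAt-top (suc p) = refl
  ... | no Q≢top rewrite colourH-run p≢m Q≢top | edgeAt-run (suc p) Q Q≢top | isEven = refl

  colourH-even-in : ∀ {p Q} → odd (suc p) ≡ false → p ≢ m → Q ≤ top → colourH (suc p) (cycPred t Q) ≡ edgeBefore (suc p) Q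
  colourH-even-in {Q = zero}  _    p≢m _ = colourH-wrap p≢m
  colourH-even-in {Q = suc Q} isEven p≢m l rewrite colourH-run p≢m (<⇒≢ l) | isEven = refl

  colourH-odd-out : ∀ {p Q} → odd (suc p) ≡ true → p ≢ m → Q ≤ top → colourH (suc p) Q ≡ edgeBefore (suc p) (top ∸ Q)
  colourH-odd-out {p} {Q} isOdd p≢m l with Q ≟ top
  ... | yes refl rewrite colourH-wrap p≢m | n∸n≡0 top = refl
  ... | no Q≢top rewrite colourH-run p≢m Q≢top | isOdd with top ∸ Q | m<n⇒0<n∸m (≤∧≢⇒< l Q≢top)
  ...   | suc _ | _ = refl

  colourH-odd-in : ∀ {p Q} → odd (suc p) ≡ true → p ≢ m → Q ≤ top → colourH (suc p) (cycPred t Q) ≡ edgeAt (suc p) (top ∸ Q)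
  colourH-odd-in {p} {zero}  _   p≢m _ rewrite colourH-wrap p≢m | edgeAt-top (suc p) = refl
  colourH-odd-in {p} {suc Q} isOdd p≢m l
    rewrite colourH-run p≢m (<⇒≢ l) | isOdd | pred[m∸n]≡m∸[1+n] top Q
          | edgeAt-run (suc p) (top ∸ suc Q) (<⇒≢ (∸-monoʳ-< {top} {suc Q} {0} (s≤s z≤n) l)) = refl

  bridgeIndex-odd : ∀ P Q → odd P ≡ true → bridgeIndex P Q ≡ Q
  bridgeIndex-odd P Q isOdd rewrite isOdd = refl

  bridgeIndex-even : ∀ P Q → odd P ≡ false → bridgeIndex P Q ≡ top ∸ Q
  bridgeIndex-even P Q isEven rewrite isEven = refl

  vertexMiddle : ∀ p {Q} → suc p ≤ m → Q ≤ top →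
                 Distinct4 (colourH (suc p) Q) (colourH (suc p) (cycPred t Q)) (colourV (suc p) Q) (colourV p Q)
  vertexMiddle p {Q} P≤m Q≤top = byParity (odd-dichotomy (suc p))
    where
    p≢m : p ≢ m
    p≢m = <⇒≢ P≤m
    P≢sm : suc p ≢ suc m
    P≢sm = <⇒≢ (s≤s P≤m)
    p≢sm : p ≢ suc m
    p≢sm = <⇒≢ (≤-trans P≤m (n≤1+n m))
    byParity : odd (suc p) ≡ true ⊎ odd (suc p) ≡ false →
               Distinct4 (colourH (suc p) Q) (colourH (suc p) (cycPred t Q)) (colourV (suc p) Q) (colourV p Q)
    byParity (inj₂ isEven) =
      distinct4-≡ (colourH-even-out Q isEven p≢m) (colourH-even-in isEven p≢m Q≤top)
                  (trans (colourV-bridge Q P≢sm) (cong (bridgeColour (suc p)) (bridgeIndex-even (suc p) Q isEven)))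
                  (trans (colourV-bridge Q p≢sm) (cong (bridgeColour p) (bridgeIndex-odd p Q (odd-pred {p} isEven))))
                  (vertexColumn p P≤m (row Q Q≤top))
    byParity (inj₁ isOdd) =
      distinct4-≡ (colourH-odd-out isOdd p≢m Q≤top) (colourH-odd-in isOdd p≢m Q≤top)
                  (trans (colourV-bridge Q P≢sm) (cong (bridgeColour (suc p)) (trans (bridgeIndex-odd (suc p) Q isOdd) (sym (m∸[m∸n]≡n Q≤top)))))
                  (trans (colourV-bridge Q p≢sm) (cong (bridgeColour p) (bridgeIndex-even p Q (odd-pred {p} isOdd))))
                  (distinct4-swap (vertexColumn p P≤m (row (top ∸ Q) (m∸n≤m top Q))))

  vertex : ∀ P Q → P < s → Q < t →
           Distinct4 (colourH P Q) (colourH P (cycPred t Q)) (colourV P Q) (colourV (cycPred s P) Q)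
  vertex zero    Q _ Q<t = vertex₀ (row Q (s≤s⁻¹ Q<t))
  vertex (suc p) Q P<s Q<t with m≤n⇒m<n∨m≡n (s≤s⁻¹ (s≤s⁻¹ P<s))
  ... | inj₁ P≤m  = vertexMiddle p P≤m (s≤s⁻¹ Q<t)
  ... | inj₂ refl = vertexₗ (row Q (s≤s⁻¹ Q<t))

  lastPos : ℕ
  lastPos = suc m * t + top

  1≤m : 1 ≤ m
  1≤m = s≤s z≤n

  pos₀-nearDouble : NearDouble pos₀
  pos₀-nearDouble = nearDouble-bit (not ∘ odd)

  posₗ-nearDouble : NearDouble posₗ
  posₗ-nearDouble = nearDouble-bit odd

  2top<2t : suc (top + top) < 2 * t
  2top<2t = s≤s (≤-reflexive (sym (trans (cong (top +_) (+-identityʳ t)) (+-suc top top))))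

  column-end : ∀ P {x} → x ≤ top → P * t + x < suc P * t
  column-end P {x} l = subst (P * t + x <_) (+-comm (P * t) t) (+-monoʳ-< (P * t) (s≤s l))

  columns-apart : ∀ {P P′} x → P ≤ P′ → P * t ≤ P′ * t + x
  columns-apart x l = ≤-trans (*-monoˡ-≤ t l) (m≤m+n _ x)

  near-double<2t : ∀ {f} → NearDouble f → ∀ {x} → x ≤ top → f x < 2 * t
  near-double<2t nd {x} l = ≤-<-trans (proj₂ (nd x)) (≤-<-trans (s≤s (+-mono-≤ l l)) 2top<2t)

  small-sum : ∀ {j j′} → j < h → j′ < h → suc (j + j′) < top
  small-sum {j} {j′} l l′ = subst (_≤ top) (cong suc (+-suc j j′)) (+-mono-≤ l l′)

  small≤top∸small : ∀ {j j′} → j < h → j′ < h → j ≤ top ∸ j′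
  small≤top∸small {j} l l′ = m+n≤o⇒m≤o∸n j (<⇒≤ (<-trans (n<1+n _) (small-sum l l′)))

  small<top∸small : ∀ {j j′} → j < h → j′ < h → j′ < top ∸ j
  small<top∸small {j′ = j′} l l′ = m+n≤o⇒m≤o∸n (suc j′) (<⇒≤ (small-sum l′ l))

  odd-gap : ∀ {x y} → odd x ≡ odd y → x < y → suc (suc x) ≤ y
  odd-gap {x} e x<y with m≤n⇒m<n∨m≡n x<y
  ... | inj₁ gap  = gap
  ... | inj₂ refl = ⊥-elim (not-¬ refl e)

  -- The chords of length > 1 on each page. Indexing by colour literals lets the coverage checker
  -- discard all pairs of chords on different pages.
  data Page : Colour → ℕ → ℕ → Set where
    unit     : ∀ {c lo} → Page c lo (suc lo)
    outer    : Page cE 0 lastPos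
    bridge₀A : ∀ j → j < h → Page cA (pos₀ (top ∸ j)) (2 * t + j)
    bridgeA  : ∀ P j → 1 ≤ P → P < m → j < h → Page cA (suc P * t + (top ∸ j)) (suc (suc P) * t + j)
    bridgeₗA : ∀ j → j < h → Page cA (posₗ j) (suc m * t + (top ∸ j))
    bridge₀B : ∀ j → h ≤ j → j ≤ top → Page cB (pos₀ (top ∸ j)) (2 * t + j)
    bridgeB  : ∀ P j → 1 ≤ P → P < m → odd P ≡ false → j ≤ top → Page cB (suc P * t + (top ∸ j)) (suc (suc P) * t + j)
    bridgeC  : ∀ P j → 1 ≤ P → P < m → odd P ≡ true → j ≤ top → Page cC (suc P * t + (top ∸ j)) (suc (suc P) * t + j)
    bridgeₗC : ∀ j → h ≤ j → j ≤ top → Page cC (posₗ j) (suc m * t + (top ∸ j))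
    legC     : Page cC 0 3
    legB     : Page cB (top⁻ + top⁻) (3 + (top⁻ + top⁻))
    legD     : ∀ q → 1 ≤ q → q < top⁻ → odd q ≡ true → Page cD (q + q) (3 + (q + q))
    legE     : ∀ q → 1 ≤ q → q < top⁻ → odd q ≡ false → Page cE (q + q) (3 + (q + q))
    wrapD    : Page cD (suc m * t) (suc m * t + top)
    wrapE    : ∀ P → 1 ≤ P → P < m → Page cE (suc P * t) (suc P * t + top)
    wrap₀    : Page cE 1 (suc (top + top))
    wrapₗ    : Page cD 0 (top + top)

  2t≤column : ∀ {P} x → 1 ≤ P → 2 * t ≤ suc P * t + x
  2t≤column x 1≤P = columns-apart x (s≤s 1≤P)

  far-bridges : ∀ {P P′ j} x → suc (suc P) ≤ P′ → j ≤ top → suc (suc P) * t + j ≤ suc P′ * t + x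
  far-bridges {P} x gap l = ≤-trans (<⇒≤ (column-end (suc (suc P)) l)) (columns-apart x (s≤s gap))

  near-bridges : ∀ {P P′ j j′} → P < P′ → j < h → j′ < h → suc (suc P) * t + j ≤ suc P′ * t + (top ∸ j′)
  near-bridges P<P′ l l′ = +-mono-≤ (*-monoˡ-≤ t (s≤s P<P′)) (small≤top∸small l l′)

  2top≡ : top + top ≡ 2 + (top⁻ + top⁻)
  2top≡ = cong suc (+-suc top⁻ top⁻)

  leg≤2t : ∀ {q} → q ≤ top⁻ → 3 + (q + q) ≤ 2 * t
  leg≤2t l = ≤-trans (s≤s (s≤s (s≤s (+-mono-≤ l l)))) (≤-trans (≤-reflexive (cong suc (sym 2top≡))) (<⇒≤ 2top<2t))

  leg≤2top : ∀ {q} → q < top⁻ → 3 + (q + q) ≤ top + top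
  leg≤2top l = ≤-trans (s≤s (s≤s (double-< l))) (≤-reflexive (sym 2top≡))

  wraps-apart : ∀ {P P′} → P < P′ → suc P * t + top ≤ suc P′ * t
  wraps-apart {P} lt = ≤-trans (<⇒≤ (column-end (suc P) ≤-refl)) (*-monoˡ-≤ t (s≤s lt))

  legs-apart : ∀ {q q′} → suc (suc q) ≤ q′ → 3 + (q + q) ≤ q′ + q′
  legs-apart {q} gap = ≤-trans (≤-trans (n≤1+n _) (≤-reflexive (cong (2 +_) (sym (trans (+-suc q (suc q)) (cong suc (+-suc q q)))))))
                                (+-mono-≤ gap gap)

  bridges₀-nested : ∀ j j′ → ¬ Interleave (pos₀ (top ∸ j)) (2 * t + j) (pos₀ (top ∸ j′)) (2 * t + j′)
  bridges₀-nested = ¬interleave-growing (nearDouble-mono pos₀-nearDouble ∘ ∸-monoʳ-≤ top) (+-monoʳ-≤ (2 * t))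

  bridgesₗ-nested : ∀ j j′ → ¬ Interleave (posₗ j) (suc m * t + (top ∸ j)) (posₗ j′) (suc m * t + (top ∸ j′))
  bridgesₗ-nested = ¬interleave-shrinking (nearDouble-mono posₗ-nearDouble) (+-monoʳ-≤ (suc m * t) ∘ ∸-monoʳ-≤ top)

  ¬interleave-bridges : ∀ P₁ P₂ j₁ j₂ →
    suc P₁ * t + (top ∸ j₁) < suc (suc P₁) * t + j₁ → suc P₂ * t + (top ∸ j₂) < suc (suc P₂) * t + j₂ →
    (P₁ < P₂ → suc (suc P₁) * t + j₁ ≤ suc P₂ * t + (top ∸ j₂)) →
    (P₂ < P₁ → suc (suc P₂) * t + j₂ ≤ suc P₁ * t + (top ∸ j₁)) →
    ¬ Interleave (suc P₁ * t + (top ∸ j₁)) (suc (suc P₁) * t + j₁) (suc P₂ * t + (top ∸ j₂)) (suc (suc P₂) * t + j₂)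
  ¬interleave-bridges P₁ P₂ j₁ j₂ l₁ l₂ before after with <-cmp P₁ P₂
  ... | tri< P₁<P₂ _ _ = ¬interleave-disjoint l₁ (before P₁<P₂)
  ... | tri≈ _ refl _  = ¬interleave-growing (+-monoʳ-≤ (suc P₁ * t) ∘ ∸-monoʳ-≤ top) (+-monoʳ-≤ (suc (suc P₁) * t)) _ _
  ... | tri> _ _ P₂<P₁ = ¬interleave-disjoint l₂ (after P₂<P₁) ∘ interleave-sym

  ¬interleave-legs : ∀ q₁ q₂ → odd q₁ ≡ odd q₂ → ¬ Interleave (q₁ + q₁) (3 + (q₁ + q₁)) (q₂ + q₂) (3 + (q₂ + q₂))
  ¬interleave-legs q₁ q₂ e with <-cmp q₁ q₂
  ... | tri< q₁<q₂ _ _ = ¬interleave-disjoint (m<n+m (q₁ + q₁) {3} z<s) (legs-apart (odd-gap e q₁<q₂))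
  ... | tri≈ _ refl _  = ¬interleave-nested ≤-refl ≤-refl
  ... | tri> _ _ q₂<q₁ = ¬interleave-disjoint (m<n+m (q₂ + q₂) {3} z<s) (legs-apart (odd-gap (sym e) q₂<q₁)) ∘ interleave-sym

  ¬interleave-wraps : ∀ P₁ P₂ → ¬ Interleave (suc P₁ * t) (suc P₁ * t + top) (suc P₂ * t) (suc P₂ * t + top)
  ¬interleave-wraps P₁ P₂ with <-cmp P₁ P₂
  ... | tri< P₁<P₂ _ _ = ¬interleave-disjoint (m<m+n _ z<s) (wraps-apart P₁<P₂)
  ... | tri≈ _ refl _  = ¬interleave-nested ≤-refl ≤-refl
  ... | tri> _ _ P₂<P₁ = ¬interleave-disjoint (m<m+n _ z<s) (wraps-apart P₂<P₁) ∘ interleave-sym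

  bridgeₗA≤bridge₀A : ∀ {j j′} → j < h → j′ < h → posₗ j′ ≤ pos₀ (top ∸ j)
  bridgeₗA≤bridge₀A {j} {j′} y y′ = ≤-trans (proj₂ (posₗ-nearDouble j′))
    (≤-trans (double-< (small<top∸small y y′)) (proj₁ (pos₀-nearDouble (top ∸ j))))

  bridge₀B≤legB : ∀ {j} → h ≤ j → pos₀ (top ∸ j) ≤ top⁻ + top⁻
  bridge₀B≤legB {j} x = ≤-trans (proj₂ (pos₀-nearDouble (top ∸ j))) (≤-trans (s≤s (+-mono-≤ j′≤h j′≤h)) (double-< h<top⁻))
    where j′≤h : top ∸ j ≤ h
          j′≤h = subst (top ∸ j ≤_) top∸h (∸-monoʳ-≤ top x)

  3≤bridgeₗC : ∀ {j} → h ≤ j → 3 ≤ posₗ j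
  3≤bridgeₗC {j} x = ≤-trans (≤-trans (s≤s (s≤s (s≤s z≤n))) (≤-trans x (m≤m+n j j))) (proj₁ (posₗ-nearDouble j))

  2top+1≤column : ∀ {P} → 1 ≤ P → suc (top + top) ≤ suc P * t
  2top+1≤column 1≤P = ≤-trans (<⇒≤ 2top<2t) (*-monoˡ-≤ t (s≤s 1≤P))

  2top≤column : ∀ {P} → 1 ≤ P → top + top ≤ suc P * t
  2top≤column 1≤P = ≤-trans (n≤1+n _) (2top+1≤column 1≤P)

  pages-noCross : ∀ {c lo hi lo′ hi′} → Page c lo hi → Page c lo′ hi′ → lo < hi → lo′ < hi′ →
                  hi ≤ lastPos → hi′ ≤ lastPos → ¬ Interleave lo hi lo′ hi′
  pages-noCross unit _     _ _ _ _  = ¬interleave-unit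
  pages-noCross _ unit     _ _ _ _  = ¬interleave-unit ∘ interleave-sym
  pages-noCross outer _    _ _ _ b₂ = ¬interleave-nested z≤n b₂
  pages-noCross _ outer    _ _ b₁ _ = ¬interleave-nested z≤n b₁ ∘ interleave-sym
  pages-noCross (bridge₀A j₁ _) (bridge₀A j₂ _) _ _ _ _ = bridges₀-nested j₁ j₂
  pages-noCross (bridge₀A _ y₁) (bridgeA _ _ 1≤P _ y₂) l₁ _ _ _ =
    ¬interleave-disjoint l₁ (+-mono-≤ (*-monoˡ-≤ t (s≤s 1≤P)) (small≤top∸small y₁ y₂))
  pages-noCross (bridgeA _ _ 1≤P _ y₁) (bridge₀A _ y₂) _ l₂ _ _ =
    ¬interleave-disjoint l₂ (+-mono-≤ (*-monoˡ-≤ t (s≤s 1≤P)) (small≤top∸small y₂ y₁)) ∘ interleave-sym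
  pages-noCross (bridge₀A j₁ y₁) (bridgeₗA j₂ y₂) _ _ _ _ = ¬interleave-nested (bridgeₗA≤bridge₀A y₁ y₂) (near-bridges 1≤m y₁ y₂) ∘ interleave-sym
  pages-noCross (bridgeₗA j₁ y₁) (bridge₀A j₂ y₂) _ _ _ _ = ¬interleave-nested (bridgeₗA≤bridge₀A y₂ y₁) (near-bridges 1≤m y₂ y₁)
  pages-noCross (bridgeA P₁ j₁ _ _ y₁) (bridgeA P₂ j₂ _ _ y₂) l₁ l₂ _ _ =
    ¬interleave-bridges P₁ P₂ j₁ j₂ l₁ l₂ (λ lt → near-bridges lt y₁ y₂) (λ gt → near-bridges gt y₂ y₁)
  pages-noCross (bridgeA _ _ 1≤P P<m y₁) (bridgeₗA _ y₂) _ _ _ _ =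
    ¬interleave-nested (≤-trans (<⇒≤ (near-double<2t posₗ-nearDouble (<⇒≤ (<-trans y₂ h<top)))) (2t≤column _ 1≤P))
                       (near-bridges P<m y₁ y₂) ∘ interleave-sym
  pages-noCross (bridgeₗA _ y₁) (bridgeA _ _ 1≤P P<m y₂) _ _ _ _ =
    ¬interleave-nested (≤-trans (<⇒≤ (near-double<2t posₗ-nearDouble (<⇒≤ (<-trans y₁ h<top)))) (2t≤column _ 1≤P))
                       (near-bridges P<m y₂ y₁)
  pages-noCross (bridgeₗA j₁ _) (bridgeₗA j₂ _) _ _ _ _ = bridgesₗ-nested j₁ j₂
  pages-noCross (bridge₀B j₁ _ _) (bridge₀B j₂ _ _) _ _ _ _ = bridges₀-nested j₁ j₂
  pages-noCross (bridge₀B _ _ y₁) (bridgeB _ _ 1≤P _ even _) l₁ _ _ _ =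
    ¬interleave-disjoint l₁ (far-bridges {0} _ (odd-gap (sym even) 1≤P) y₁)
  pages-noCross (bridgeB _ _ 1≤P _ even _) (bridge₀B _ _ y₂) _ l₂ _ _ =
    ¬interleave-disjoint l₂ (far-bridges {0} _ (odd-gap (sym even) 1≤P) y₂) ∘ interleave-sym
  pages-noCross (bridge₀B _ x₁ _) legB _ _ _ _ = ¬interleave-nested (bridge₀B≤legB x₁) (≤-trans (leg≤2t ≤-refl) (m≤m+n _ _))
  pages-noCross legB (bridge₀B _ x₂ _) _ _ _ _ = ¬interleave-nested (bridge₀B≤legB x₂) (≤-trans (leg≤2t ≤-refl) (m≤m+n _ _)) ∘ interleave-sym
  pages-noCross (bridgeB P₁ j₁ _ _ e₁ y₁) (bridgeB P₂ j₂ _ _ e₂ y₂) l₁ l₂ _ _ =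
    ¬interleave-bridges P₁ P₂ j₁ j₂ l₁ l₂ (λ lt → far-bridges _ (odd-gap (trans e₁ (sym e₂)) lt) y₁) (λ gt → far-bridges _ (odd-gap (trans e₂ (sym e₁)) gt) y₂)
  pages-noCross (bridgeB _ _ 1≤P _ _ _) legB _ l₂ _ _ = ¬interleave-disjoint l₂ (≤-trans (leg≤2t ≤-refl) (2t≤column _ 1≤P)) ∘ interleave-sym
  pages-noCross legB (bridgeB _ _ 1≤P _ _ _) l₁ _ _ _ = ¬interleave-disjoint l₁ (≤-trans (leg≤2t ≤-refl) (2t≤column _ 1≤P))
  pages-noCross legB legB _ _ _ _ = ¬interleave-nested ≤-refl ≤-refl
  pages-noCross (bridgeC P₁ j₁ _ _ e₁ y₁) (bridgeC P₂ j₂ _ _ e₂ y₂) l₁ l₂ _ _ =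
    ¬interleave-bridges P₁ P₂ j₁ j₂ l₁ l₂ (λ lt → far-bridges _ (odd-gap (trans e₁ (sym e₂)) lt) y₁) (λ gt → far-bridges _ (odd-gap (trans e₂ (sym e₁)) gt) y₂)
  pages-noCross (bridgeC _ _ 1≤P P<m odd₁ y₁) (bridgeₗC _ _ y₂) _ _ _ _ =
    ¬interleave-nested (≤-trans (<⇒≤ (near-double<2t posₗ-nearDouble y₂)) (2t≤column _ 1≤P))
                       (far-bridges _ (odd-gap (trans odd₁ (sym odd-m)) P<m) y₁) ∘ interleave-sym
  pages-noCross (bridgeₗC _ _ y₁) (bridgeC _ _ 1≤P P<m odd₂ y₂) _ _ _ _ =
    ¬interleave-nested (≤-trans (<⇒≤ (near-double<2t posₗ-nearDouble y₁)) (2t≤column _ 1≤P))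
                       (far-bridges _ (odd-gap (trans odd₂ (sym odd-m)) P<m) y₂)
  pages-noCross (bridgeC _ _ 1≤P _ _ _) legC _ l₂ _ _ = ¬interleave-disjoint l₂ (≤-trans (leg≤2t z≤n) (2t≤column _ 1≤P)) ∘ interleave-sym
  pages-noCross legC (bridgeC _ _ 1≤P _ _ _) l₁ _ _ _ = ¬interleave-disjoint l₁ (≤-trans (leg≤2t z≤n) (2t≤column _ 1≤P))
  pages-noCross (bridgeₗC j₁ _ _) (bridgeₗC j₂ _ _) _ _ _ _ = bridgesₗ-nested j₁ j₂
  pages-noCross (bridgeₗC _ x₁ _) legC _ l₂ _ _ = ¬interleave-disjoint l₂ (3≤bridgeₗC x₁) ∘ interleave-sym
  pages-noCross legC (bridgeₗC _ x₂ _) l₁ _ _ _ = ¬interleave-disjoint l₁ (3≤bridgeₗC x₂)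
  pages-noCross legC legC _ _ _ _ = ¬interleave-nested ≤-refl ≤-refl
  pages-noCross (legD q₁ _ _ e₁) (legD q₂ _ _ e₂) _ _ _ _ = ¬interleave-legs q₁ q₂ (trans e₁ (sym e₂))
  pages-noCross (legD _ _ q<top⁻ _) wrapD l₁ _ _ _ = ¬interleave-disjoint l₁ (≤-trans (leg≤2t (<⇒≤ q<top⁻)) (*-monoˡ-≤ t (s≤s 1≤m)))
  pages-noCross wrapD (legD _ _ q<top⁻ _) _ l₂ _ _ = ¬interleave-disjoint l₂ (≤-trans (leg≤2t (<⇒≤ q<top⁻)) (*-monoˡ-≤ t (s≤s 1≤m))) ∘ interleave-sym
  pages-noCross (legD _ _ q<top⁻ _) wrapₗ _ _ _ _ = ¬interleave-nested z≤n (leg≤2top q<top⁻) ∘ interleave-sym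
  pages-noCross wrapₗ (legD _ _ q<top⁻ _) _ _ _ _ = ¬interleave-nested z≤n (leg≤2top q<top⁻)
  pages-noCross wrapD wrapD _ _ _ _ = ¬interleave-nested ≤-refl ≤-refl
  pages-noCross wrapD wrapₗ _ l₂ _ _ = ¬interleave-disjoint l₂ (2top≤column 1≤m) ∘ interleave-sym
  pages-noCross wrapₗ wrapD l₁ _ _ _ = ¬interleave-disjoint l₁ (2top≤column 1≤m)
  pages-noCross wrapₗ wrapₗ _ _ _ _ = ¬interleave-nested ≤-refl ≤-refl
  pages-noCross (legE q₁ _ _ e₁) (legE q₂ _ _ e₂) _ _ _ _ = ¬interleave-legs q₁ q₂ (trans e₁ (sym e₂))
  pages-noCross (legE _ _ q<top⁻ _) (wrapE _ 1≤P _) l₁ _ _ _ = ¬interleave-disjoint l₁ (≤-trans (leg≤2t (<⇒≤ q<top⁻)) (*-monoˡ-≤ t (s≤s 1≤P)))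
  pages-noCross (wrapE _ 1≤P _) (legE _ _ q<top⁻ _) _ l₂ _ _ = ¬interleave-disjoint l₂ (≤-trans (leg≤2t (<⇒≤ q<top⁻)) (*-monoˡ-≤ t (s≤s 1≤P))) ∘ interleave-sym
  pages-noCross (legE _ 1≤q q<top⁻ _) wrap₀ _ _ _ _ = ¬interleave-nested (≤-trans 1≤q (m≤m+n _ _)) (≤-trans (leg≤2top q<top⁻) (n≤1+n _)) ∘ interleave-sym
  pages-noCross wrap₀ (legE _ 1≤q q<top⁻ _) _ _ _ _ = ¬interleave-nested (≤-trans 1≤q (m≤m+n _ _)) (≤-trans (leg≤2top q<top⁻) (n≤1+n _))
  pages-noCross (wrapE P₁ _ _) (wrapE P₂ _ _) _ _ _ _ = ¬interleave-wraps P₁ P₂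
  pages-noCross (wrapE _ 1≤P _) wrap₀ _ l₂ _ _ = ¬interleave-disjoint l₂ (2top+1≤column 1≤P) ∘ interleave-sym
  pages-noCross wrap₀ (wrapE _ 1≤P _) l₁ _ _ _ = ¬interleave-disjoint l₁ (2top+1≤column 1≤P)
  pages-noCross wrap₀ wrap₀ _ _ _ _ = ¬interleave-nested ≤-refl ≤-refl

  record Chord (x y : ℕ) (c : Colour) : Set where
    constructor chord
    field
      {low high} : ℕ
      ends       : Ends x y low high
      low<high   : low < high
      page       : Page c low high

  recolour : ∀ {c c′ lo hi} → c ≡ c′ → Page c′ lo hi → Page c lo hi
  recolour refl P = P

  unitChord : ∀ {x y c} lo → Ends x y lo (suc lo) → Chord x y c
  unitChord _ ends = chord ends ≤-refl unit

  chords-noCross : ∀ {x y x′ y′ c} → Chord x y c → Chord x′ y′ c →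
                   x ≤ lastPos → y ≤ lastPos → x′ ≤ lastPos → y′ ≤ lastPos → ¬ Cross x y x′ y′
  chords-noCross (chord ends l page) (chord ends′ l′ page′) x≤ y≤ x′≤ y′≤ =
    pages-noCross page page′ l l′ (hi≤ ends x≤ y≤) (hi≤ ends′ x′≤ y′≤) ∘ cross⇒interleave l l′ ∘ cross-ends ends ends′
    where
    hi≤ : ∀ {x y lo hi} → Ends x y lo hi → x ≤ lastPos → y ≤ lastPos → hi ≤ lastPos
    hi≤ (inj₁ (refl , refl)) _ y≤ = y≤
    hi≤ (inj₂ (refl , refl)) x≤ _ = x≤

  alt-odd : ∀ {q} → odd q ≡ true → alt q ≡ cD
  alt-odd e rewrite e = refl

  alt-even : ∀ {q} → odd q ≡ false → alt q ≡ cE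
  alt-even e rewrite e = refl

  legPage : ∀ q → q ≤ top⁻ → Page (legColour q) (q + q) (3 + (q + q))
  legPage zero _ = legC
  legPage (suc q) l with m≤n⇒m<n∨m≡n l
  ... | inj₂ refl = recolour legColour-top⁻ legB
  ... | inj₁ q<top⁻ with odd-dichotomy (suc q)
  ...   | inj₁ isOdd  = recolour (trans (legColour-interior (s≤s z≤n) q<top⁻) (alt-odd {suc q} isOdd)) (legD (suc q) (s≤s z≤n) q<top⁻ isOdd)
  ...   | inj₂ isEven = recolour (trans (legColour-interior (s≤s z≤n) q<top⁻) (alt-even {suc q} isEven)) (legE (suc q) (s≤s z≤n) q<top⁻ isEven)

  wrapPage : ∀ P → 1 ≤ P → P ≤ m → Page (wrapColour P) (suc P * t) (suc P * t + top)
  wrapPage P 1≤P P≤m with m≤n⇒m<n∨m≡n P≤m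
  ... | inj₁ P<m  = recolour (wrapColour-middle (<⇒≢ P<m)) (wrapE P 1≤P P<m)
  ... | inj₂ refl = recolour wrapColour-m wrapD

  pos-ₗ : ∀ Q → pos (suc m) Q ≡ posₗ Q
  pos-ₗ Q rewrite dec-true (m ≟ m) refl = refl

  pos-middle : ∀ {p} Q → p ≢ m → pos (suc p) Q ≡ suc (suc p) * t + offset (suc p) Q
  pos-middle {p} Q ne rewrite dec-false (p ≟ m) ne = refl

  offset-odd : ∀ P Q → odd P ≡ true → offset P Q ≡ top ∸ Q
  offset-odd P Q isOdd rewrite isOdd = refl

  offset-even : ∀ P Q → odd P ≡ false → offset P Q ≡ Q
  offset-even P Q isEven rewrite isEven = refl

  pos₀-odd : ∀ Q → odd Q ≡ true → pos₀ Q ≡ Q + Q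
  pos₀-odd Q isOdd rewrite isOdd = +-identityʳ (Q + Q)

  pos₀-even : ∀ Q → odd Q ≡ false → pos₀ Q ≡ suc (Q + Q)
  pos₀-even Q isEven rewrite isEven = +-comm (Q + Q) 1

  posₗ-odd : ∀ Q → odd Q ≡ true → posₗ Q ≡ suc (Q + Q)
  posₗ-odd Q isOdd rewrite isOdd = +-comm (Q + Q) 1

  posₗ-even : ∀ Q → odd Q ≡ false → posₗ Q ≡ Q + Q
  posₗ-even Q isEven rewrite isEven = +-identityʳ (Q + Q)

  double-suc : ∀ Q → suc Q + suc Q ≡ 2 + (Q + Q)
  double-suc Q = cong suc (+-suc Q Q)

  horizontalChord₀ : ∀ Q {Q′} → Q′ < t → CycSucc t Q Q′ → Chord (pos₀ Q) (pos₀ Q′) (colourH 0 Q)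
  horizontalChord₀ Q _ (inj₂ (e , refl)) with suc-injective e
  ... | refl = chord (inj₂ (pos₀-even top odd-top , refl)) (s≤s (s≤s z≤n)) (recolour colourH₀-top wrap₀)
  horizontalChord₀ Q Q′<t (inj₁ refl) with odd-dichotomy Q
  ... | inj₁ isOdd = chord (inj₁ (pos₀-odd Q isOdd , trans (pos₀-even (suc Q) (cong not isOdd)) (cong suc (double-suc Q))))
                           (m<n+m (Q + Q) {3} z<s) (recolour (colourH₀ (<⇒≢ (s≤s⁻¹ Q′<t))) (legPage Q (s≤s⁻¹ (s≤s⁻¹ Q′<t))))
  ... | inj₂ isEven = unitChord _ (inj₁ (pos₀-even Q isEven , trans (pos₀-odd (suc Q) (cong not isEven)) (double-suc Q)))

  horizontalChordₗ : ∀ Q {Q′} → Q′ < t → CycSucc t Q Q′ → Chord (posₗ Q) (posₗ Q′) (colourH (suc m) Q)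
  horizontalChordₗ Q _ (inj₂ (e , refl)) with suc-injective e
  ... | refl = chord (inj₂ (posₗ-even top odd-top , refl)) z<s (recolour colourHₗ-top wrapₗ)
  horizontalChordₗ Q Q′<t (inj₁ refl) with odd-dichotomy Q
  ... | inj₂ isEven = chord (inj₁ (posₗ-even Q isEven , trans (posₗ-odd (suc Q) (cong not isEven)) (cong suc (double-suc Q))))
                            (m<n+m (Q + Q) {3} z<s) (recolour (colourHₗ (<⇒≢ (s≤s⁻¹ Q′<t))) (legPage Q (s≤s⁻¹ (s≤s⁻¹ Q′<t))))
  ... | inj₁ isOdd = unitChord _ (inj₁ (posₗ-odd Q isOdd , trans (posₗ-even (suc Q) (cong not isOdd)) (double-suc Q)))

  horizontalChordMiddle : ∀ {p} Q {Q′} → suc p ≤ m → Q′ < t → CycSucc t Q Q′ →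
                          Chord (pos (suc p) Q) (pos (suc p) Q′) (colourH (suc p) Q)
  horizontalChordMiddle {p} Q P≤m = go (odd-dichotomy (suc p))
    where
    X : ℕ
    X = suc (suc p) * t
    p≢m : p ≢ m
    p≢m = <⇒≢ P≤m
    wrap : Page (colourH (suc p) top) X (X + top)
    wrap = recolour (colourH-wrap p≢m) (wrapPage (suc p) (s≤s z≤n) P≤m)
    go : ∀ {Q′} → odd (suc p) ≡ true ⊎ odd (suc p) ≡ false → Q′ < t → CycSucc t Q Q′ →
         Chord (pos (suc p) Q) (pos (suc p) Q′) (colourH (suc p) Q)
    go (inj₁ isOdd) _ (inj₂ (e , refl)) rewrite suc-injective e =
      chord (inj₁ (trans (pos-middle top p≢m) (trans (cong (X +_) (trans (offset-odd (suc p) top isOdd) (n∸n≡0 top))) (+-identityʳ X)) ,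
                   trans (pos-middle 0 p≢m) (cong (X +_) (offset-odd (suc p) 0 isOdd))))
            (m<m+n X z<s) wrap
    go (inj₂ isEven) _ (inj₂ (e , refl)) rewrite suc-injective e =
      chord (inj₂ (trans (pos-middle top p≢m) (cong (X +_) (offset-even (suc p) top isEven)) ,
                   trans (pos-middle 0 p≢m) (trans (cong (X +_) (offset-even (suc p) 0 isEven)) (+-identityʳ X))))
            (m<m+n X z<s) wrap
    go (inj₁ isOdd) Q′<t (inj₁ refl) =
      unitChord _ (inj₂ (trans (pos-middle Q p≢m) (trans (cong (X +_) (trans (offset-odd (suc p) Q isOdd) (+-∸-assoc 1 (s≤s⁻¹ Q′<t)))) (+-suc X _)) ,
                         trans (pos-middle (suc Q) p≢m) (cong (X +_) (offset-odd (suc p) (suc Q) isOdd))))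
    go (inj₂ isEven) _ (inj₁ refl) =
      unitChord _ (inj₁ (trans (pos-middle Q p≢m) (cong (X +_) (offset-even (suc p) Q isEven)) ,
                         trans (pos-middle (suc Q) p≢m) (trans (cong (X +_) (offset-even (suc p) (suc Q) isEven)) (+-suc X Q))))

  chord-cong : ∀ {x y c x′ y′ c′} → x ≡ x′ → y ≡ y′ → c ≡ c′ → Chord x′ y′ c′ → Chord x y c
  chord-cong refl refl refl ch = ch

  horizontalChord : ∀ P Q {Q′} → P < s → Q′ < t → CycSucc t Q Q′ → Chord (pos P Q) (pos P Q′) (colourH P Q)
  horizontalChord zero    Q _ = horizontalChord₀ Q
  horizontalChord (suc p) Q P<s with m≤n⇒m<n∨m≡n (s≤s⁻¹ (s≤s⁻¹ P<s))
  ... | inj₁ P≤m  = horizontalChordMiddle Q P≤m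
  ... | inj₂ refl = λ Q′<t succ → chord-cong (pos-ₗ Q) (pos-ₗ _) refl (horizontalChordₗ Q Q′<t succ)

  2t≡ : 2 * t ≡ 2 + (top + top)
  2t≡ = cong suc (trans (cong (top +_) (+-identityʳ t)) (+-suc top top))

  bridge₀Page : ∀ j → 1 ≤ j → j ≤ top → Page (bridgeColour 0 j) (pos₀ (top ∸ j)) (2 * t + j)
  bridge₀Page j 1≤j j≤top with j <? h
  ... | yes j<h = recolour (bridgeColour-low 0 j 1≤j j<h) (bridge₀A j j<h)
  ... | no j≮h  = recolour (bridgeColour-high 0 j (≮⇒≥ j≮h)) (bridge₀B j (≮⇒≥ j≮h) j≤top)

  bridgePage : ∀ P j → 1 ≤ P → P < m → 1 ≤ j → j ≤ top →
               Page (bridgeColour P j) (suc P * t + (top ∸ j)) (suc (suc P) * t + j)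
  bridgePage P j 1≤P P<m 1≤j j≤top with j <? h | odd-dichotomy P
  ... | yes j<h | _          = recolour (bridgeColour-low P j 1≤j j<h) (bridgeA P j 1≤P P<m j<h)
  ... | no j≮h  | inj₁ isOdd  = recolour (trans (bridgeColour-high P j (≮⇒≥ j≮h)) (band-odd P isOdd))
                                         (bridgeC P j 1≤P P<m isOdd j≤top)
  ... | no j≮h  | inj₂ isEven = recolour (trans (bridgeColour-high P j (≮⇒≥ j≮h)) (band-even P isEven))
                                         (bridgeB P j 1≤P P<m isEven j≤top)

  bridgeₗPage : ∀ j → j ≤ top → Page (bridgeColour m j) (posₗ j) (suc m * t + (top ∸ j))
  bridgeₗPage zero    _ = recolour bridge₀Colour-m outer
  bridgeₗPage (suc j) j≤top with suc j <? h
  ... | yes j<h = recolour (bridgeColour-low m _ (s≤s z≤n) j<h) (bridgeₗA (suc j) j<h)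
  ... | no j≮h  = recolour (trans (bridgeColour-high m _ (≮⇒≥ j≮h)) band-m) (bridgeₗC (suc j) (≮⇒≥ j≮h) j≤top)

  bridge₀Chord : ∀ j → j ≤ top → Chord (pos₀ (top ∸ j)) (2 * t + j) (bridgeColour 0 j)
  bridge₀Chord zero    _     = unitChord _ (inj₁ (pos₀-even top odd-top , trans (+-identityʳ (2 * t)) 2t≡))
  bridge₀Chord (suc j) j≤top =
    chord (inj₁ (refl , refl)) (≤-trans (near-double<2t pos₀-nearDouble (m∸n≤m top (suc j))) (m≤m+n _ _))
          (bridge₀Page (suc j) (s≤s z≤n) j≤top)

  bridgeChord : ∀ P j → 1 ≤ P → P < m → j ≤ top →
                Chord (suc P * t + (top ∸ j)) (suc (suc P) * t + j) (bridgeColour P j)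
  bridgeChord P zero _ _ _ =
    unitChord _ (inj₁ (refl , trans (+-identityʳ (suc (suc P) * t)) (cong suc (+-comm top (suc P * t)))))
  bridgeChord P (suc j) 1≤P P<m j≤top =
    chord (inj₁ (refl , refl)) (≤-trans (column-end (suc P) (m∸n≤m top (suc j))) (m≤m+n _ _))
          (bridgePage P (suc j) 1≤P P<m (s≤s z≤n) j≤top)

  bridgeₗChord : ∀ j → j ≤ top → Chord (suc m * t + (top ∸ j)) (posₗ j) (bridgeColour m j)
  bridgeₗChord j j≤top =
    chord (inj₂ (refl , refl)) (≤-trans (near-double<2t posₗ-nearDouble j≤top) (2t≤column _ 1≤m)) (bridgeₗPage j j≤top)

  rungChord : ∀ Q {c} → Chord (posₗ Q) (pos₀ Q) c
  rungChord Q with odd-dichotomy Q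
  ... | inj₁ isOdd  = unitChord _ (inj₂ (posₗ-odd Q isOdd , pos₀-odd Q isOdd))
  ... | inj₂ isEven = unitChord _ (inj₁ (posₗ-even Q isEven , pos₀-even Q isEven))

  verticalChord : ∀ P {P′} Q → P′ < s → Q < t → CycSucc s P P′ → Chord (pos P Q) (pos P′ Q) (colourV P Q)
  verticalChord P Q _ _ (inj₂ (e , refl)) rewrite suc-injective e = chord-cong (pos-ₗ Q) refl refl (rungChord Q)
  verticalChord zero Q _ Q<t (inj₁ refl) =
    chord-cong (cong pos₀ (sym (m∸[m∸n]≡n (s≤s⁻¹ Q<t)))) refl refl (bridge₀Chord (top ∸ Q) (m∸n≤m top Q))
  verticalChord (suc p) Q P′<s Q<t (inj₁ refl) with m≤n⇒m<n∨m≡n (s≤s⁻¹ (s≤s⁻¹ P′<s))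
  ... | inj₂ refl = chord-cong (trans (pos-middle Q kk≢m) (cong (suc m * t +_) (offset-odd m Q odd-m))) (pos-ₗ Q) (colourV-m Q)
                               (bridgeₗChord Q (s≤s⁻¹ Q<t))
  ... | inj₁ P<m with odd-dichotomy (suc p)
  ...   | inj₁ isOdd =
    chord-cong (trans (pos-middle Q (<⇒≢ (<⇒≤ P<m))) (cong (suc (suc p) * t +_) (offset-odd (suc p) Q isOdd)))
               (trans (pos-middle Q (<⇒≢ P<m)) (cong (suc (suc (suc p)) * t +_) (offset-even (suc (suc p)) Q (cong not isOdd))))
               (trans (colourV-bridge Q (<⇒≢ (s≤s (<⇒≤ P<m)))) (cong (bridgeColour (suc p)) (bridgeIndex-odd (suc p) Q isOdd)))
               (bridgeChord (suc p) Q (s≤s z≤n) P<m (s≤s⁻¹ Q<t))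
  ...   | inj₂ isEven =
    chord-cong (trans (pos-middle Q (<⇒≢ (<⇒≤ P<m))) (cong (suc (suc p) * t +_)
                      (trans (offset-even (suc p) Q isEven) (sym (m∸[m∸n]≡n (s≤s⁻¹ Q<t))))))
               (trans (pos-middle Q (<⇒≢ P<m)) (cong (suc (suc (suc p)) * t +_) (offset-odd (suc (suc p)) Q (cong not isEven))))
               (trans (colourV-bridge Q (<⇒≢ (s≤s (<⇒≤ P<m)))) (cong (bridgeColour (suc p)) (bridgeIndex-even (suc p) Q isEven)))
               (bridgeChord (suc p) (top ∸ Q) (s≤s z≤n) P<m (m∸n≤m top Q))

  data Column : ℕ → Set where
    first  : Column 0
    middle : ∀ p → suc p ≤ m → Column (suc p)
    last   : Column (suc m)

  column : ∀ {P} → P < s → Column P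
  column {zero}  _   = first
  column {suc p} P<s with m≤n⇒m<n∨m≡n (s≤s⁻¹ (s≤s⁻¹ P<s))
  ... | inj₁ P≤m  = middle p P≤m
  ... | inj₂ refl = last

  offset≤top : ∀ P {Q} → Q ≤ top → offset P Q ≤ top
  offset≤top P {Q} Q≤top with odd P
  ... | true  = m∸n≤m top Q
  ... | false = Q≤top

  offset-injective : ∀ P {Q Q′} → Q ≤ top → Q′ ≤ top → offset P Q ≡ offset P Q′ → Q ≡ Q′
  offset-injective P l l′ e with odd P
  ... | true  = ∸-cancelˡ-≡ l l′ e
  ... | false = e

  pos₀<2t : ∀ {Q} → Q < t → pos₀ Q < 2 * t
  pos₀<2t Q<t = near-double<2t pos₀-nearDouble (s≤s⁻¹ Q<t)

  posₗ<2t : ∀ {Q} → Q < t → posₗ Q < 2 * t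
  posₗ<2t Q<t = near-double<2t posₗ-nearDouble (s≤s⁻¹ Q<t)

  2t≤pos-middle : ∀ {p} Q → suc p ≤ m → 2 * t ≤ pos (suc p) Q
  2t≤pos-middle {p} Q P≤m rewrite pos-middle Q (<⇒≢ P≤m) = columns-apart {2} {suc (suc p)} _ (s≤s (s≤s z≤n))

  pos≤lastPos : ∀ {P Q} → P < s → Q < t → pos P Q ≤ lastPos
  pos≤lastPos {P} {Q} P<s Q<t with column P<s
  ... | first = ≤-trans (<⇒≤ (pos₀<2t Q<t)) (2t≤column top 1≤m)
  ... | last rewrite pos-ₗ Q = ≤-trans (<⇒≤ (posₗ<2t Q<t)) (2t≤column top 1≤m)
  ... | middle p P≤m rewrite pos-middle Q (<⇒≢ P≤m) =
    +-mono-≤ (*-monoˡ-≤ t (s≤s P≤m)) (offset≤top (suc p) (s≤s⁻¹ Q<t))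

  pos₀≢posₗ : ∀ Q Q′ → pos₀ Q ≢ posₗ Q′
  pos₀≢posₗ Q Q′ e with nearDouble-injective pos₀-nearDouble posₗ-nearDouble {Q} {Q′} e
  ... | refl with odd Q | +-cancelˡ-≡ (Q + Q) _ _ e
  ...   | true  | ()
  ...   | false | ()

  pos-injective : ∀ {P Q P′ Q′} → P < s → Q < t → P′ < s → Q′ < t → pos P Q ≡ pos P′ Q′ → P ≡ P′ × Q ≡ Q′
  pos-injective {P} {Q} {P′} {Q′} P<s Q<t P′<s Q′<t e with column P<s | column P′<s
  ... | first | first = refl , nearDouble-injective pos₀-nearDouble pos₀-nearDouble e
  ... | first | last  = ⊥-elim (pos₀≢posₗ Q Q′ (trans e (pos-ₗ Q′)))
  ... | last  | first = ⊥-elim (pos₀≢posₗ Q′ Q (trans (sym e) (pos-ₗ Q)))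
  ... | last  | last  = refl , nearDouble-injective posₗ-nearDouble posₗ-nearDouble (trans (sym (pos-ₗ Q)) (trans e (pos-ₗ Q′)))
  ... | first | middle _ P′≤m = ⊥-elim (<⇒≱ (pos₀<2t Q<t) (≤-trans (2t≤pos-middle Q′ P′≤m) (≤-reflexive (sym e))))
  ... | middle _ P≤m | first  = ⊥-elim (<⇒≱ (pos₀<2t Q′<t) (≤-trans (2t≤pos-middle Q P≤m) (≤-reflexive e)))
  ... | last | middle _ P′≤m  = ⊥-elim (<⇒≱ (posₗ<2t Q<t) (≤-trans (2t≤pos-middle Q′ P′≤m) (≤-reflexive (sym (trans (sym (pos-ₗ Q)) e)))))
  ... | middle _ P≤m | last   = ⊥-elim (<⇒≱ (posₗ<2t Q′<t) (≤-trans (2t≤pos-middle Q P≤m) (≤-reflexive (trans e (pos-ₗ Q′)))))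
  ... | middle p P≤m | middle p′ P′≤m
    with refl , offsets ← *+-injective (suc (suc p)) (suc (suc p′))
                             (s≤s (offset≤top (suc p) (s≤s⁻¹ Q<t))) (s≤s (offset≤top (suc p′) (s≤s⁻¹ Q′<t)))
                             (trans (sym (pos-middle Q (<⇒≢ P≤m))) (trans e (pos-middle Q′ (<⇒≢ P′≤m))))
    = refl , offset-injective (suc p) (s≤s⁻¹ Q<t) (s≤s⁻¹ Q′<t) offsets

  suc-lastPos : suc lastPos ≡ s * t
  suc-lastPos = trans (sym (+-suc (suc m * t) top)) (+-comm (suc m * t) t)

  stepChord : ∀ {u v} (e : Step s t u v) → Chord (pos (toℕ (proj₁ u)) (toℕ (proj₂ u))) (pos (toℕ (proj₁ v)) (toℕ (proj₂ v)))
                                                 (stepColour colourH colourV e)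
  stepChord (right {p} {q} {q′} sq) = horizontalChord (toℕ p) (toℕ q) (toℕ<n p) (toℕ<n q′) sq
  stepChord (down {p} {p′} {q} sp)  = verticalChord (toℕ p) (toℕ q) (toℕ<n p′) (toℕ<n q) sp

  layout : TorusLayout s t 5
  layout = record
    { place             = λ (p , q) → pos (toℕ p) (toℕ q)
    ; place<            = λ (p , q) → subst (pos (toℕ p) (toℕ q) <_) suc-lastPos (s≤s (pos≤lastPos (toℕ<n p) (toℕ<n q)))
    ; place-injective   = λ {(p , q)} {(p′ , q′)} e →
        let (P≡P′ , Q≡Q′) = pos-injective (toℕ<n p) (toℕ<n q) (toℕ<n p′) (toℕ<n q′) e
        in cong₂ _,_ (toℕ-injective P≡P′) (toℕ-injective Q≡Q′)
    ; colourH           = colourH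
    ; colourV           = colourV
    ; incident-distinct = λ p q → vertex (toℕ p) (toℕ q) (toℕ<n p) (toℕ<n q)
    ; steps-noCross     = λ {(p , q)} {(p₁ , q₁)} {(p′ , q′)} {(p₁′ , q₁′)} e e′ cr same →
        chords-noCross (stepChord e) (chord-cong refl refl same (stepChord e′))
          (pos≤lastPos (toℕ<n p) (toℕ<n q)) (pos≤lastPos (toℕ<n p₁) (toℕ<n q₁))
          (pos≤lastPos (toℕ<n p′) (toℕ<n q′)) (pos≤lastPos (toℕ<n p₁′) (toℕ<n q₁′)) cr
    }

odd⇒double+1 : ∀ n → n % 2 ≡ 1 → ∃ λ c → n ≡ suc (c + c)
odd⇒double+1 n n%2≡1 = n / 2 , (begin
  n                    ≡⟨ m≡m%n+[m/n]*n n 2 ⟩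
  n % 2 + n / 2 * 2    ≡⟨ cong₂ _+_ n%2≡1 (*-comm (n / 2) 2) ⟩
  1 + 2 * (n / 2)      ≡⟨ cong (λ x → suc (n / 2 + x)) (+-identityʳ (n / 2)) ⟩
  suc (n / 2 + n / 2)  ∎)
  where open ≡-Reasoning

half-mono : ∀ {c d} → c + c ≤ d + d → c ≤ d
half-mono {c} {d} l with <-cmp c d
... | tri< c<d _ _ = <⇒≤ c<d
... | tri≈ _ refl _ = ≤-refl
... | tri> _ _ d<c = ⊥-elim (<⇒≱ (+-mono-< d<c d<c) l)

lemma2p2 : (s t : ℕ) → s % 2 ≡ 1 → t % 2 ≡ 1 → 7 ≤ t → t ≤ s →
    MatchingBookEmbedding (Torus s t) (s * t) 5
lemma2p2 s t s-odd t-odd 7≤t t≤s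
  with c , refl ← odd⇒double+1 t t-odd | d , refl ← odd⇒double+1 s s-odd
  with a , refl ← m≤n⇒∃[o]m+o≡n (half-mono {3} {c} (s≤s⁻¹ 7≤t))
  with b , refl ← m≤n⇒∃[o]m+o≡n (≤-trans (half-mono {3} {c} (s≤s⁻¹ 7≤t)) (half-mono {c} {d} (s≤s⁻¹ t≤s)))
  = subst (λ S → MatchingBookEmbedding (Torus S t) (S * t) 5) (cong (suc ∘ suc) (sym (+-suc (2 + b) (2 + b))))
          (layout⇒embedding (Construction.layout a b) (s≤s (s≤s (s≤s z≤n))) (s≤s (s≤s (s≤s z≤n))))
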